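{- Let $\Pi$ be a partial quadrangle in which every triad has the same number $c$ of centers, and let $\Gamma$ be the point graph of $\Pi$. Then $\Gamma$ is $\mathbb{T}$-regular for every graph-type $\mathbb{T}$ of order $(3,4)$ except possibly the following six types. In each, $\Theta$ has vertices $x,y,z,u$, $\Delta$ is the induced subgraph of $\Theta$ on $\{x,y,z\}$ with $\iota$ the inclusion, and the edges of $\Theta$ are: (1) $xy,ux,uy,uz$; (2) $xy,ux,uy$; (3) $xy,ux,uz$; (4) $xy,ux$; (5) $xy,uz$; (6) $xy$ only.
   Context: A partial linear space of order $(s,t)$: points and lines with incidence, each line incident with $s+1$ points, each point with $t+1$ lines, two distinct points on at most one common line; distinct points are collinear if on a common line. A partial quadrangle with parameters $(s,t,\mu)$ is a partial linear space of order $(s,t)$ in which any three pairwise collinear points lie on one line and any two non-collinear points have exactly $\mu$ points collinear with both. Its point graph has the points as vertices, adjacent iff collinear. A triad is a set of three pairwise non-collinear points; a center of a triad is a point collinear with all three. A graph-type is a triple $\mathbb{T}=(\Delta,\iota,\Theta)$ of finite simple graphs with an embedding (injective map preserving edges and non-edges) $\iota:\Delta\hookrightarrow\Theta$, of order $(|V(\Delta)|,|V(\Theta)|)$; graph-types are considered up to isomorphism (isomorphisms of $\Delta$ and $\Theta$ commuting with the embeddings). $\Gamma$ is $\mathbb{T}$-regular if the number of embeddings $\hat\kappa:\Theta\hookrightarrow\Gamma$ with $\hat\kappa\circ\iota=\kappa$ is the same for all embeddings $\kappa:\Delta\hookrightarrow\Gamma$. -}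

module Defs where

open import Data.Nat using (ℕ; zero; suc; _+_)
open import Data.Bool using (Bool; true; false; T; _∧_)
open import Data.Fin using (Fin; zero; suc; _≟_; inject₁)
open import Data.Fin.Properties using (any?; all?; inject₁-injective)
open import Data.List using (List; []; _∷_; map; concatMap; allFin)
open import Data.Product using (Σ; _×_; _,_; ∃)
open import Data.Sum using (_⊎_)
open import Relation.Binary.PropositionalEquality using (_≡_; _≢_; cong)
open import Relation.Nullary using (Dec; yes; no; ¬_; does)
open import Relation.Nullary.Decidable using (_×-dec_; _⊎-dec_; _→-dec_; ¬?)
open import Function.Definitions using (Injective; Surjective)

count : ∀ {n} {P : Fin n → Set} → (∀ i → Dec (P i)) → ℕ
count {zero}  P? = 0
count {suc n} P? = (if? (P? zero)) + count (λ i → P? (suc i))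
  where
  if? : ∀ {A : Set} → Dec A → ℕ
  if? (yes _) = 1
  if? (no _)  = 0

countL : ∀ {A : Set} {P : A → Set} → (∀ a → Dec (P a)) → List A → ℕ
countL P? []       = 0
countL P? (a ∷ as) with P? a
... | yes _ = suc (countL P? as)
... | no  _ = countL P? as

-- the complete (duplicate-free) list of all maps Fin b → Fin m
consF : ∀ {b m} → Fin m → (Fin b → Fin m) → Fin (suc b) → Fin m
consF x f zero    = x
consF x f (suc i) = f i

allFuns : ∀ b m → List (Fin b → Fin m)
allFuns zero    m = (λ ()) ∷ []
allFuns (suc b) m = concatMap (λ x → map (consF x) (allFuns b m)) (allFin m)

-- A graph is given by a Bool-valued "edge" function; the adjacency
-- relation is its symmetrisation with loops removed, so every such
-- object is a finite simple graph and every finite simple graph on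
-- Fin n arises this way.

Graph : ℕ → Set
Graph n = Fin n → Fin n → Bool

Adj : ∀ {n} → Graph n → Fin n → Fin n → Set
Adj G i j = i ≢ j × (T (G i j) ⊎ T (G j i))

Adj? : ∀ {n} (G : Graph n) i j → Dec (Adj G i j)
Adj? G i j = ¬? (i ≟ j) ×-dec (T? (G i j) ⊎-dec T? (G j i))
  where
  T? : ∀ b → Dec (T b)
  T? true  = yes _
  T? false = no (λ ())

IsEmbedding : ∀ {a b} → Graph a → Graph b → (Fin a → Fin b) → Set
IsEmbedding G H f =
  (∀ i j → f i ≡ f j → i ≡ j) × (∀ i j → (Adj H (f i) (f j) → Adj G i j) × (Adj G i j → Adj H (f i) (f j)))

IsEmbedding? : ∀ {a b} (G : Graph a) (H : Graph b) f → Dec (IsEmbedding G H f)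
IsEmbedding? G H f =
  all? (λ i → all? (λ j → (f i ≟ f j) →-dec (i ≟ j)))
  ×-dec all? (λ i → all? (λ j →
          (Adj? H (f i) (f j) →-dec Adj? G i j) ×-dec (Adj? G i j →-dec Adj? H (f i) (f j))))

record GraphType (a b : ℕ) : Set where
  field
    Δ     : Graph a
    Θ     : Graph b
    ι     : Fin a → Fin b
    ι-emb : IsEmbedding Δ Θ ι

IsIso : ∀ {a b} → Graph a → Graph b → (Fin a → Fin b) → Set
IsIso G H f = IsEmbedding G H f × (∀ y → ∃ λ x → f x ≡ y)

_≅ᵀ_ : ∀ {a b} → GraphType a b → GraphType a b → Set
_≅ᵀ_ {a} {b} T₁ T₂ =
  Σ (Fin a → Fin a) λ α → Σ (Fin b → Fin b) λ β →
    IsIso (GraphType.Δ T₁) (GraphType.Δ T₂) α ×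
    IsIso (GraphType.Θ T₁) (GraphType.Θ T₂) β ×
    (∀ i → β (GraphType.ι T₁ i) ≡ GraphType.ι T₂ (α i))

extCount : ∀ {a b m} → (Γ : Graph m) → GraphType a b → (Fin a → Fin m) → ℕ
extCount {a} {b} {m} Γ T κ =
  countL (λ κ̂ → IsEmbedding? Θ Γ κ̂ ×-dec all? (λ i → κ̂ (ι i) ≟ κ i)) (allFuns b m)
  where open GraphType T

IsTRegular : ∀ {a b m} → Graph m → GraphType a b → Set
IsTRegular Γ T =
  ∃ λ N → ∀ κ → IsEmbedding (GraphType.Δ T) Γ κ → extCount Γ T κ ≡ N

edgesFrom : ∀ {n} → List (Fin n × Fin n) → Graph n
edgesFrom []             i j = false
edgesFrom ((a , b) ∷ es) i j with does (i ≟ a) ∧ does (j ≟ b)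
... | true  = true
... | false = edgesFrom es i j

x y z u : Fin 4
x = zero
y = suc zero
z = suc (suc zero)
u = suc (suc (suc zero))

incl : Fin 3 → Fin 4
incl = inject₁

incl-emb : ∀ {n} (Θ' : Graph (suc n)) →
  IsEmbedding (λ i j → Θ' (inject₁ i) (inject₁ j)) Θ' inject₁
incl-emb Θ' =
  (λ i j → inject₁-injective) ,
  (λ i j → (λ { (i≢j , e) → (λ i≡j → i≢j (cong inject₁ i≡j)) , e })
         , (λ { (i≢j , e) → (λ ii≡ij → i≢j (inject₁-injective ii≡ij)) , e }))

inducedType : Graph 4 → GraphType 3 4
inducedType Θ' = record
  { Δ = λ i j → Θ' (incl i) (incl j)
  ; Θ = Θ'
  ; ι = incl
  ; ι-emb = incl-emb Θ'
  }

exceptional : Fin 6 → GraphType 3 4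
exceptional zero = inducedType (edgesFrom ((x , y) ∷ (u , x) ∷ (u , y) ∷ (u , z) ∷ []))
exceptional (suc zero) = inducedType (edgesFrom ((x , y) ∷ (u , x) ∷ (u , y) ∷ []))
exceptional (suc (suc zero)) = inducedType (edgesFrom ((x , y) ∷ (u , x) ∷ (u , z) ∷ []))
exceptional (suc (suc (suc zero))) = inducedType (edgesFrom ((x , y) ∷ (u , x) ∷ []))
exceptional (suc (suc (suc (suc zero)))) = inducedType (edgesFrom ((x , y) ∷ (u , z) ∷ []))
exceptional (suc (suc (suc (suc (suc zero))))) = inducedType (edgesFrom ((x , y) ∷ []))

record IncidenceStructure : Set where
  field
    np nl : ℕ
    I     : Fin np → Fin nl → Bool

module _ (S : IncidenceStructure) where
  open IncidenceStructure S

  Point = Fin np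
  Line  = Fin nl

  _on_ : Point → Line → Set
  p on l = T (I p l)

  on? : ∀ p l → Dec (p on l)
  on? p l = T?′ (I p l)
    where
    T?′ : ∀ b → Dec (T b)
    T?′ true  = yes _
    T?′ false = no (λ ())

  Collinear : Point → Point → Set
  Collinear p q = p ≢ q × ∃ λ l → p on l × q on l

  Collinear? : ∀ p q → Dec (Collinear p q)
  Collinear? p q = ¬? (p ≟ q) ×-dec any? (λ l → on? p l ×-dec on? q l)

  record IsPartialLinearSpace (s t : ℕ) : Set where
    field
      line-size   : ∀ l → count (λ p → on? p l) ≡ suc s
      point-deg   : ∀ p → count (λ l → on? p l) ≡ suc t
      unique-line : ∀ p q → p ≢ q → ∀ l l′ →
                    p on l → q on l → p on l′ → q on l′ → l ≡ l′

  record IsPartialQuadrangle (s t μ : ℕ) : Set where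
    field
      pls       : IsPartialLinearSpace s t
      triangles : ∀ p q r → Collinear p q → Collinear q r → Collinear p r →
                  ∃ λ l → p on l × q on l × r on l
      mu        : ∀ p q → p ≢ q → ¬ Collinear p q →
                  count (λ r → Collinear? p r ×-dec Collinear? q r) ≡ μ

  IsTriad : Point → Point → Point → Set
  IsTriad p q r = (p ≢ q × q ≢ r × p ≢ r) ×
                  (¬ Collinear p q × ¬ Collinear q r × ¬ Collinear p r)

  centers : Point → Point → Point → ℕ
  centers p q r = count (λ w → Collinear? w p ×-dec Collinear? w q ×-dec Collinear? w r)

  pointGraph : Graph np
  pointGraph p q = does (Collinear? p q)

-- Fix an embedding κ of Δ into the point graph.  An extension of κ to Θ is determined by the image u
-- of the apex (the vertex of Θ outside ι(Δ)), so the number of extensions counts the points u outside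
-- κ(Δ) whose collinearity with κ(0), κ(1), κ(2) follows a prescribed pattern.  By inclusion–exclusion
-- this count is determined by the numbers of common neighbours of the subsets of {κ(0), κ(1), κ(2)},
-- corrected by the contribution of the three points themselves, which depends on Δ only.  In a
-- partial quadrangle these numbers depend only on the collinearities: a point has (t+1)s neighbours,
-- two collinear points have s−1 and two non-collinear ones μ common neighbours, and three points have
-- s−2 (on a line), 0 (a path) or c (a triad).  Only the pattern with exactly one collinear pair is
-- undetermined, and the graph-types with such a Δ are, up to isomorphism, the six exceptional ones.

module Submission where

open import Defs
open import Data.Unit using (⊤; tt)
open import Data.Empty using (⊥)
open import Data.Bool using (Bool; true; false; T; if_then_else_)
open import Data.Nat using (ℕ; zero; suc; _+_; _*_)
open import Data.Nat.Properties
  using (+-*-semiring; suc-injective; +-comm; +-assoc; *-comm; *-assoc; +-identityʳ; *-identityˡ; *-identityʳ;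
         *-distribˡ-+; *-distribʳ-+; +-cancelˡ-≡; +-cancelʳ-≡)
open import Algebra.Properties.Semiring.Sum +-*-semiring
  using (sum; sum-syntax; sum-cong-≗; sum-replicate-zero; ∑-distrib-+; ∑-comm; *-distribˡ-sum; *-distribʳ-sum)
open import Data.Fin using (Fin; zero; suc; _≟_)
open import Data.Fin.Patterns using (0F; 1F; 2F; 3F)
open import Data.List using (List; []; _∷_; _++_; map; concatMap; tabulate)
open import Data.List.Relation.Unary.Any using (Any; here)
open import Data.List.Relation.Unary.Any.Properties using (concat⁺; map⁺; tabulate⁺)
import Data.List.Relation.Unary.Any as Any
open import Data.Fin.Properties using (any?; all?)
import Data.Fin.Properties as Fin
open import Data.Product using (∃; _×_; _,_; proj₁; proj₂)
open import Data.Sum using (_⊎_; inj₁; inj₂; [_,_]′)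
import Data.Sum as Sum
open import Function using (_∘_; _⇔_; mk⇔; Equivalence)
open import Relation.Binary.PropositionalEquality
  using (_≡_; _≢_; _≗_; refl; sym; trans; cong; cong₂; subst; subst₂; module ≡-Reasoning)
open import Relation.Nullary using (Dec; yes; no; ¬_; does; contradiction)
open import Relation.Nullary.Decidable using (_×-dec_; _⊎-dec_; _→-dec_; ¬?; map′; isYes; toWitness; fromWitness; T?)

open Equivalence using (to; from)
import Function.Properties.Equivalence as ⇔

𝟙 : ∀ {A : Set} → Dec A → ℕ
𝟙 a? = if does a? then 1 else 0

𝟙-cong : ∀ {A B : Set} → A ⇔ B → (a? : Dec A) (b? : Dec B) → 𝟙 a? ≡ 𝟙 b?
𝟙-cong A⇔B (yes _) (yes _) = refl
𝟙-cong A⇔B (yes a) (no ¬b) = contradiction (to A⇔B a) ¬b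
𝟙-cong A⇔B (no ¬a) (yes b) = contradiction (from A⇔B b) ¬a
𝟙-cong A⇔B (no _)  (no _)  = refl

𝟙-× : ∀ {A B : Set} (a? : Dec A) (b? : Dec B) → 𝟙 (a? ×-dec b?) ≡ 𝟙 a? * 𝟙 b?
𝟙-× a? b? with does a?
... | true  = sym (+-identityʳ _)
... | false = refl

𝟙-yes : ∀ {A : Set} → A → (a? : Dec A) → 𝟙 a? ≡ 1
𝟙-yes a (yes _) = refl
𝟙-yes a (no ¬a) = contradiction a ¬a

𝟙-no : ∀ {A : Set} → ¬ A → (a? : Dec A) → 𝟙 a? ≡ 0
𝟙-no ¬a (yes a) = contradiction a ¬a
𝟙-no ¬a (no _)  = refl

𝟙+𝟙¬ : ∀ {A : Set} (a? : Dec A) → 𝟙 a? + 𝟙 (¬? a?) ≡ 1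
𝟙+𝟙¬ a? with does a?
... | true  = refl
... | false = refl

count≡∑𝟙 : ∀ {n} {P : Fin n → Set} (P? : ∀ i → Dec (P i)) → count P? ≡ ∑[ i < n ] 𝟙 (P? i)
count≡∑𝟙 {zero}  P? = refl
count≡∑𝟙 {suc n} P? with P? zero
... | yes _ = cong suc (count≡∑𝟙 (λ i → P? (suc i)))
... | no  _ = count≡∑𝟙 (λ i → P? (suc i))

∑-split : ∀ {n} {f g h : Fin n → ℕ} → (∀ i → f i ≡ g i + h i) → sum f ≡ sum g + sum h
∑-split {g = g} {h} f≡g+h = trans (sum-cong-≗ f≡g+h) (∑-distrib-+ g h)

∑-single : ∀ {n} (a : Fin n) (f : Fin n → ℕ) → (∀ i → i ≢ a → f i ≡ 0) → sum f ≡ f a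
∑-single {suc n} zero    f f≡0 =
  trans (cong (f zero +_) (trans (sum-cong-≗ (λ i → f≡0 (suc i) λ ())) (sum-replicate-zero n))) (+-identityʳ _)
∑-single {suc n} (suc a) f f≡0 = trans (cong (_+ sum (λ i → f (suc i))) (f≡0 zero λ ()))
                                        (∑-single a (λ i → f (suc i)) (λ i i≢a → f≡0 (suc i) (i≢a ∘ Fin.suc-injective)))

∑-remove : ∀ {n} (a : Fin n) (f : Fin n → ℕ) → sum f ≡ ∑[ u < n ] (𝟙 (¬? (u ≟ a)) * f u) + f a
∑-remove {n} a f = begin
  sum f                   ≡⟨ ∑-split split ⟩
  sum others + sum at-a   ≡⟨ cong (sum others +_) (∑-single a at-a off-a) ⟩
  sum others + at-a a     ≡⟨ cong (sum others +_) (trans (cong (_* f a) (𝟙-yes refl (a ≟ a))) (+-identityʳ (f a))) ⟩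
  sum others + f a        ∎
  where
  open ≡-Reasoning
  others at-a : Fin n → ℕ
  others u = 𝟙 (¬? (u ≟ a)) * f u
  at-a   u = 𝟙 (u ≟ a) * f u
  split : ∀ u → f u ≡ others u + at-a u
  split u = begin
    f u                                       ≡⟨ sym (+-identityʳ (f u)) ⟩
    1 * f u                                   ≡⟨ cong (_* f u) (sym (𝟙+𝟙¬ (u ≟ a))) ⟩
    (𝟙 (u ≟ a) + 𝟙 (¬? (u ≟ a))) * f u       ≡⟨ *-distribʳ-+ (f u) (𝟙 (u ≟ a)) (𝟙 (¬? (u ≟ a))) ⟩
    at-a u + others u                         ≡⟨ +-comm (at-a u) (others u) ⟩
    others u + at-a u                         ∎
  off-a : ∀ u → u ≢ a → at-a u ≡ 0
  off-a u u≢a = cong (_* f u) (𝟙-no u≢a (u ≟ a))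

𝟙-any?-unique : ∀ {n} {Q : Fin n → Set} (Q? : ∀ l → Dec (Q l)) → (∀ l l′ → Q l → Q l′ → l ≡ l′) →
                𝟙 (any? Q?) ≡ ∑[ l < n ] 𝟙 (Q? l)
𝟙-any?-unique {n} Q? unique with any? Q?
... | yes (l , q) =
  sym (trans (∑-single l _ (λ l′ l′≢l → 𝟙-no (λ q′ → l′≢l (unique l′ l q′ q)) (Q? l′))) (𝟙-yes q (Q? l)))
... | no ∄ = sym (trans (sum-cong-≗ (λ l → 𝟙-no (λ q → ∄ (l , q)) (Q? l))) (sum-replicate-zero n))

𝟙-×₃ : ∀ {A B C : Set} (a? : Dec A) (b? : Dec B) (c? : Dec C) → 𝟙 (a? ×-dec b? ×-dec c?) ≡ 𝟙 a? * (𝟙 b? * 𝟙 c?)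
𝟙-×₃ a? b? c? = trans (𝟙-× a? (b? ×-dec c?)) (cong (𝟙 a? *_) (𝟙-× b? c?))

IsInjective : ∀ {A B : Set} → (A → B) → Set
IsInjective f = ∀ i j → f i ≡ f j → i ≡ j

injective⇒≢ : ∀ {A B : Set} {f : A → B} → IsInjective f → ∀ {i j} → i ≢ j → f i ≢ f j
injective⇒≢ f-inj i≢j = i≢j ∘ f-inj _ _

_∉?_ : ∀ {k n} (u : Fin n) (κ : Fin k → Fin n) → Dec (∀ i → u ≢ κ i)
_∉?_ {zero}  u κ = yes λ ()
_∉?_ {suc k} u κ = map′ (λ (u≢κ₀ , u∉) → λ { zero → u≢κ₀ ; (suc i) → u∉ i }) (λ u∉ → u∉ zero , u∉ ∘ suc)
                        (¬? (u ≟ κ zero) ×-dec (u ∉? (κ ∘ suc)))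

∑-image : ∀ {k n} (κ : Fin k → Fin n) → IsInjective κ → (f : Fin n → ℕ) →
          sum f ≡ ∑[ u < n ] (𝟙 (u ∉? κ) * f u) + ∑[ i < k ] f (κ i)
∑-image {zero}  {n} κ _ f = sym (trans (+-identityʳ _) (sum-cong-≗ (λ u → +-identityʳ (f u))))
∑-image {suc k} {n} κ κ-inj f = begin
  sum f                             ≡⟨ ∑-remove κ₀ f ⟩
  sum g + f κ₀                      ≡⟨ cong (_+ f κ₀) (∑-image (κ ∘ suc) κ⁺-inj g) ⟩
  outside′ + rest′ + f κ₀           ≡⟨ cong₂ (λ x y → x + y + f κ₀) (sum-cong-≗ regroup) (sum-cong-≗ off-κ₀) ⟩
  outside + rest + f κ₀             ≡⟨ +-assoc outside rest (f κ₀) ⟩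
  outside + (rest + f κ₀)           ≡⟨ cong (outside +_) (+-comm rest (f κ₀)) ⟩
  outside + ∑[ i < suc k ] f (κ i)  ∎
  where
  open ≡-Reasoning
  κ₀ : Fin n
  κ₀ = κ zero
  κ⁺-inj : IsInjective (κ ∘ suc)
  κ⁺-inj i j = Fin.suc-injective ∘ κ-inj (suc i) (suc j)
  g : Fin n → ℕ
  g u = 𝟙 (¬? (u ≟ κ₀)) * f u
  outside rest outside′ rest′ : ℕ
  outside  = ∑[ u < n ] (𝟙 (u ∉? κ) * f u)
  rest     = ∑[ i < k ] f (κ (suc i))
  outside′ = ∑[ u < n ] (𝟙 (u ∉? (κ ∘ suc)) * g u)
  rest′    = ∑[ i < k ] g (κ (suc i))
  regroup : ∀ u → 𝟙 (u ∉? (κ ∘ suc)) * g u ≡ 𝟙 (u ∉? κ) * f u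
  regroup u = begin
    𝟙 (u ∉? (κ ∘ suc)) * (𝟙 (¬? (u ≟ κ₀)) * f u)     ≡⟨ sym (*-assoc (𝟙 (u ∉? (κ ∘ suc))) _ (f u)) ⟩
    𝟙 (u ∉? (κ ∘ suc)) * 𝟙 (¬? (u ≟ κ₀)) * f u       ≡⟨ cong (_* f u) (*-comm (𝟙 (u ∉? (κ ∘ suc))) _) ⟩
    𝟙 (¬? (u ≟ κ₀)) * 𝟙 (u ∉? (κ ∘ suc)) * f u       ≡⟨ cong (_* f u) (sym (𝟙-× (¬? (u ≟ κ₀)) (u ∉? (κ ∘ suc)))) ⟩
    𝟙 (u ∉? κ) * f u                                 ∎
  off-κ₀ : ∀ i → g (κ (suc i)) ≡ f (κ (suc i))
  off-κ₀ i = trans (cong (_* f (κ (suc i))) (𝟙-yes (injective⇒≢ κ-inj λ ()) (¬? (κ (suc i) ≟ κ₀)))) (+-identityʳ _)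

countL-∷ : ∀ {A : Set} {P : A → Set} (P? : ∀ a → Dec (P a)) a as → countL P? (a ∷ as) ≡ 𝟙 (P? a) + countL P? as
countL-∷ P? a as with P? a
... | yes _ = refl
... | no  _ = refl

module _ {A : Set} {P : A → Set} (P? : ∀ a → Dec (P a)) where

  countL-++ : ∀ as bs → countL P? (as ++ bs) ≡ countL P? as + countL P? bs
  countL-++ []       bs = refl
  countL-++ (a ∷ as) bs = begin
    countL P? (a ∷ as ++ bs)                   ≡⟨ countL-∷ P? a (as ++ bs) ⟩
    𝟙 (P? a) + countL P? (as ++ bs)            ≡⟨ cong (𝟙 (P? a) +_) (countL-++ as bs) ⟩
    𝟙 (P? a) + (countL P? as + countL P? bs)   ≡⟨ sym (+-assoc (𝟙 (P? a)) _ _) ⟩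
    𝟙 (P? a) + countL P? as + countL P? bs     ≡⟨ cong (_+ countL P? bs) (sym (countL-∷ P? a as)) ⟩
    countL P? (a ∷ as) + countL P? bs          ∎
    where open ≡-Reasoning

  countL-none : ∀ as → (∀ a → ¬ P a) → countL P? as ≡ 0
  countL-none []       ∄ = refl
  countL-none (a ∷ as) ∄ = trans (countL-∷ P? a as) (cong₂ _+_ (𝟙-no (∄ a) (P? a)) (countL-none as ∄))

  countL-concatMap-tabulate : ∀ {B : Set} {n} (g : B → List A) (f : Fin n → B) →
    countL P? (concatMap g (tabulate f)) ≡ ∑[ i < n ] countL P? (g (f i))
  countL-concatMap-tabulate {n = zero}  g f = refl
  countL-concatMap-tabulate {n = suc n} g f =
    trans (countL-++ (g (f zero)) _) (cong (countL P? (g (f zero)) +_) (countL-concatMap-tabulate g (f ∘ suc)))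

  countL-map : ∀ {B : Set} (h : B → A) bs → countL P? (map h bs) ≡ countL (λ b → P? (h b)) bs
  countL-map h []       = refl
  countL-map h (b ∷ bs) = begin
    countL P? (h b ∷ map h bs)                   ≡⟨ countL-∷ P? (h b) (map h bs) ⟩
    𝟙 (P? (h b)) + countL P? (map h bs)          ≡⟨ cong (𝟙 (P? (h b)) +_) (countL-map h bs) ⟩
    𝟙 (P? (h b)) + countL (λ b → P? (h b)) bs    ≡⟨ sym (countL-∷ (λ b → P? (h b)) b bs) ⟩
    countL (λ b → P? (h b)) (b ∷ bs)             ∎
    where open ≡-Reasoning

  countL-partition : ∀ {m} (π : A → Fin m) as →
    countL P? as ≡ ∑[ u < m ] countL (λ a → P? a ×-dec (π a ≟ u)) as
  countL-partition {m} π []       = sym (sum-replicate-zero m)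
  countL-partition {m} π (a ∷ as) = begin
    countL P? (a ∷ as)                                  ≡⟨ countL-∷ P? a as ⟩
    𝟙 (P? a) + countL P? as                             ≡⟨ cong₂ _+_ at-a (countL-partition π as) ⟩
    ∑[ u < m ] 𝟙 (Q? u a) + ∑[ u < m ] countL (Q? u) as
      ≡⟨ sym (∑-distrib-+ (λ u → 𝟙 (Q? u a)) (λ u → countL (Q? u) as)) ⟩
    ∑[ u < m ] (𝟙 (Q? u a) + countL (Q? u) as)          ≡⟨ sum-cong-≗ (λ u → sym (countL-∷ (Q? u) a as)) ⟩
    ∑[ u < m ] countL (Q? u) (a ∷ as)                   ∎
    where
    open ≡-Reasoning
    Q? : ∀ u b → Dec (P b × π b ≡ u)
    Q? u b = P? b ×-dec (π b ≟ u)
    at-a : 𝟙 (P? a) ≡ ∑[ u < m ] 𝟙 (Q? u a)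
    at-a = sym (trans (∑-single (π a) _ (λ u u≢πa → 𝟙-no (λ (_ , πa≡u) → u≢πa (sym πa≡u)) (Q? u a)))
                      (𝟙-cong (mk⇔ proj₁ (_, refl)) (Q? (π a) a) (P? a)))

Respects≗ : ∀ {b m} → ((Fin b → Fin m) → Set) → Set
Respects≗ P = ∀ {f g} → f ≗ g → P f → P g

consF-cong : ∀ {b m} (x : Fin m) {f g : Fin b → Fin m} → f ≗ g → consF x f ≗ consF x g
consF-cong x f≗g zero    = refl
consF-cong x f≗g (suc i) = f≗g i

consF-head-tail : ∀ {b m} (f : Fin (suc b) → Fin m) → consF (f zero) (f ∘ suc) ≗ f
consF-head-tail f zero    = refl
consF-head-tail f (suc i) = refl

allFuns-complete : ∀ b m (f : Fin b → Fin m) → Any (_≗ f) (allFuns b m)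
allFuns-complete zero    m f = here λ ()
allFuns-complete (suc b) m f =
  concat⁺ (map⁺ (tabulate⁺ (f zero) (map⁺ (Any.map tail≗ (allFuns-complete b m (f ∘ suc))))))
  where
  tail≗ : ∀ {g} → g ≗ f ∘ suc → consF (f zero) g ≗ f
  tail≗ g≗ i = trans (consF-cong (f zero) g≗ i) (consF-head-tail f i)

countL-allFuns-unique : ∀ b {m} {P : (Fin b → Fin m) → Set} (P? : ∀ f → Dec (P f)) → Respects≗ P →
  (g : Fin b → Fin m) → (∀ f → P f → f ≗ g) → countL P? (allFuns b m) ≡ 𝟙 (P? g)
countL-allFuns-unique zero P? resp g _ =
  trans (countL-∷ P? _ []) (trans (+-identityʳ _) (𝟙-cong (mk⇔ (resp λ ()) (resp λ ())) (P? _) (P? g)))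
countL-allFuns-unique (suc b) {m} {P} P? resp g unique = begin
  countL P? (allFuns (suc b) m)                        ≡⟨ countL-concatMap-tabulate P? starting (λ x → x) ⟩
  ∑[ x < m ] countL P? (starting x)                    ≡⟨ sum-cong-≗ (λ x → countL-map P? (consF x) (allFuns b m)) ⟩
  ∑[ x < m ] countL (P?∘consF x) (allFuns b m)         ≡⟨ ∑-single (g zero) _ off-head ⟩
  countL (P?∘consF (g zero)) (allFuns b m)             ≡⟨ countL-allFuns-unique b _ resp-tail (g ∘ suc) on-tail ⟩
  𝟙 (P? (consF (g zero) (g ∘ suc)))                    ≡⟨ 𝟙-cong head-tail⇔ (P? (consF (g zero) (g ∘ suc))) (P? g) ⟩
  𝟙 (P? g)                                             ∎
  where
  open ≡-Reasoning
  starting : Fin m → List (Fin (suc b) → Fin m)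
  starting x = map (consF x) (allFuns b m)
  P?∘consF : ∀ x f → Dec (P (consF x f))
  P?∘consF x f = P? (consF x f)
  off-head : ∀ x → x ≢ g zero → countL (P?∘consF x) (allFuns b m) ≡ 0
  off-head x x≢g₀ = countL-none _ (allFuns b m) (λ f p → x≢g₀ (unique _ p zero))
  resp-tail : Respects≗ (P ∘ consF (g zero))
  resp-tail = resp ∘ consF-cong (g zero)
  on-tail : ∀ f → P (consF (g zero) f) → f ≗ g ∘ suc
  on-tail f p i = unique _ p (suc i)
  head-tail⇔ : P (consF (g zero) (g ∘ suc)) ⇔ P g
  head-tail⇔ = mk⇔ (resp (consF-head-tail g)) (resp (sym ∘ consF-head-tail g))

countL-allFuns-determined : ∀ {b m} {P : (Fin b → Fin m) → Set} (P? : ∀ f → Dec (P f)) → Respects≗ P →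
  (w : Fin b) (e : Fin m → Fin b → Fin m) → (∀ u → e u w ≡ u) → (∀ f → P f → f ≗ e (f w)) →
  countL P? (allFuns b m) ≡ ∑[ u < m ] 𝟙 (P? (e u))
countL-allFuns-determined {b} {m} P? resp w e e-w determined = begin
  countL P? (allFuns b m)                                       ≡⟨ countL-partition P? (λ f → f w) (allFuns b m) ⟩
  ∑[ u < m ] countL (λ f → P? f ×-dec (f w ≟ u)) (allFuns b m) ≡⟨ sum-cong-≗ fibre ⟩
  ∑[ u < m ] 𝟙 (P? (e u))                                       ∎
  where
  open ≡-Reasoning
  fibre : ∀ u → countL (λ f → P? f ×-dec (f w ≟ u)) (allFuns b m) ≡ 𝟙 (P? (e u))
  fibre u = trans
    (countL-allFuns-unique b (λ f → P? f ×-dec (f w ≟ u))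
      (λ f≗g (p , fw≡u) → resp f≗g p , trans (sym (f≗g w)) fw≡u) (e u)
      (λ f (p , fw≡u) i → trans (determined f p i) (cong (λ v → e v i) fw≡u)))
    (𝟙-cong (mk⇔ proj₁ (_, e-w u)) (P? (e u) ×-dec (e u w ≟ u)) (P? (e u)))

data Literal : Set where
  pos neg free : Literal

⟦_⟧ : Literal → Set → Set
⟦ pos  ⟧ X = X
⟦ neg  ⟧ X = ¬ X
⟦ free ⟧ X = ⊤

⟦_⟧? : ∀ ℓ {X : Set} → Dec X → Dec (⟦ ℓ ⟧ X)
⟦ pos  ⟧? x? = x?
⟦ neg  ⟧? x? = ¬? x?
⟦ free ⟧? x? = yes tt

⟦_⟧-cong : ∀ ℓ {X Y : Set} → X ⇔ Y → ⟦ ℓ ⟧ X ⇔ ⟦ ℓ ⟧ Y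
⟦ pos  ⟧-cong X⇔Y = X⇔Y
⟦ neg  ⟧-cong X⇔Y = mk⇔ (λ ¬x y → ¬x (from X⇔Y y)) (λ ¬y x → ¬y (to X⇔Y x))
⟦ free ⟧-cong X⇔Y = mk⇔ _ _

literal : ∀ {A : Set} → Dec A → Literal
literal (yes _) = pos
literal (no  _) = neg

⟦literal⟧ : ∀ {A X : Set} (a? : Dec A) → ⟦ literal a? ⟧ X ⇔ (X ⇔ A)
⟦literal⟧ (yes a) = mk⇔ (λ x → mk⇔ (λ _ → a) (λ _ → x)) (λ X⇔A → from X⇔A a)
⟦literal⟧ (no ¬a) = mk⇔ (λ ¬x → mk⇔ (λ x → contradiction x ¬x) (λ a → contradiction a ¬a)) (λ X⇔A x → ¬a (to X⇔A x))

linear-free : ∀ {X : Set} (x? : Dec X) (g : ℕ → ℕ) → (∀ m n → g (m + n) ≡ g m + g n) →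
              g (𝟙 (⟦ free ⟧? x?)) ≡ g (𝟙 (⟦ pos ⟧? x?)) + g (𝟙 (⟦ neg ⟧? x?))
linear-free x? g g-+ = trans (cong g (sym (𝟙+𝟙¬ x?))) (g-+ (𝟙 x?) (𝟙 (¬? x?)))

Positive : Literal → Set
Positive neg = ⊥
Positive _   = ⊤

record Additive (F : Literal → Literal → Literal → ℕ) : Set where
  field
    split₀ : ∀ b c → F free b c ≡ F pos b c + F neg b c
    split₁ : ∀ a c → F a free c ≡ F a pos c + F a neg c
    split₂ : ∀ a b → F a b free ≡ F a b pos + F a b neg

-- Inclusion–exclusion: a negative literal is recovered as free minus positive, one coordinate at a time.
additive-≡ : ∀ {F G} → Additive F → Additive G →
  (∀ a b c → Positive a → Positive b → Positive c → F a b c ≡ G a b c) → ∀ a b c → F a b c ≡ G a b c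
additive-≡ {F} {G} addF addG positive≡ = third
  where
  open Additive
  cancel : ∀ {x y z x′ y′ z′} → x ≡ y + z → x′ ≡ y′ + z′ → x ≡ x′ → y ≡ y′ → z ≡ z′
  cancel {y = y} x≡ x′≡ refl refl = +-cancelˡ-≡ y _ _ (trans (sym x≡) x′≡)
  first : ∀ a b c → Positive b → Positive c → F a b c ≡ G a b c
  first pos  b c pb pc = positive≡ pos b c tt pb pc
  first free b c pb pc = positive≡ free b c tt pb pc
  first neg  b c pb pc =
    cancel (split₀ addF b c) (split₀ addG b c) (positive≡ free b c tt pb pc) (positive≡ pos b c tt pb pc)
  second : ∀ a b c → Positive c → F a b c ≡ G a b c
  second a pos  c pc = first a pos c tt pc
  second a free c pc = first a free c tt pc
  second a neg  c pc =
    cancel (split₁ addF a c) (split₁ addG a c) (first a free c tt pc) (first a pos c tt pc)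
  third : ∀ a b c → F a b c ≡ G a b c
  third a b pos  = second a b pos tt
  third a b free = second a b free tt
  third a b neg  =
    cancel (split₂ addF a b) (split₂ addG a b) (second a b free tt) (second a b pos tt)

Adj-sym : ∀ {n} (G : Graph n) {i j} → Adj G i j → Adj G j i
Adj-sym G (i≢j , inj₁ e) = i≢j ∘ sym , inj₂ e
Adj-sym G (i≢j , inj₂ e) = i≢j ∘ sym , inj₁ e

Adj-irrefl : ∀ {n} (G : Graph n) {i} → ¬ Adj G i i
Adj-irrefl G (i≢i , _) = i≢i refl

IsEmbedding-≗ : ∀ {a b} {G : Graph a} {H : Graph b} {f g : Fin a → Fin b} →
                f ≗ g → IsEmbedding G H f → IsEmbedding G H g
IsEmbedding-≗ {H = H} f≗g (f-inj , f-adj) =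
  (λ i j gi≡gj → f-inj i j (trans (f≗g i) (trans gi≡gj (sym (f≗g j))))) ,
  (λ i j → (λ adj → proj₁ (f-adj i j) (subst₂ (Adj H) (sym (f≗g i)) (sym (f≗g j)) adj)) ,
           (λ adj → subst₂ (Adj H) (f≗g i) (f≗g j) (proj₂ (f-adj i j) adj)))

module OneVertexExtension {a b} (𝕋 : GraphType a b) (w : Fin b) (w∉ι : ∀ i → GraphType.ι 𝕋 i ≢ w)
                          (view : ∀ j → j ≡ w ⊎ ∃ λ i → GraphType.ι 𝕋 i ≡ j) where

  open GraphType 𝕋

  extend : ∀ {m} → (Fin a → Fin m) → Fin m → Fin b → Fin m
  extend κ u j = [ (λ _ → u) , (λ (i , _) → κ i) ]′ (view j)

  vertex-elim : (P : Fin b → Set) → P w → (∀ i → P (ι i)) → ∀ j → P j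
  vertex-elim P Pw Pι j = [ (λ j≡w → subst P (sym j≡w) Pw) , (λ (i , ιi≡j) → subst P ιi≡j (Pι i)) ]′ (view j)

  extend-w : ∀ {m} (κ : Fin a → Fin m) u → extend κ u w ≡ u
  extend-w κ u with view w
  ... | inj₁ _        = refl
  ... | inj₂ (i , ιi≡w) = contradiction ιi≡w (w∉ι i)

  extend-ι : ∀ {m} (κ : Fin a → Fin m) u i → extend κ u (ι i) ≡ κ i
  extend-ι κ u i with view (ι i)
  ... | inj₁ ιi≡w        = contradiction ιi≡w (w∉ι i)
  ... | inj₂ (i′ , ιi′≡ιi) = cong κ (proj₁ ι-emb i′ i ιi′≡ιi)

  IsExtension : ∀ {m} → Graph m → (Fin a → Fin m) → (Fin b → Fin m) → Set
  IsExtension Γ κ f = IsEmbedding Θ Γ f × (∀ i → f (ι i) ≡ κ i)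

  IsExtension? : ∀ {m} (Γ : Graph m) κ f → Dec (IsExtension Γ κ f)
  IsExtension? Γ κ f = IsEmbedding? Θ Γ f ×-dec all? (λ i → f (ι i) ≟ κ i)

  extension-determined : ∀ {m} {Γ : Graph m} {κ} f → IsExtension Γ κ f → f ≗ extend κ (f w)
  extension-determined {κ = κ} f (_ , f∘ι≡κ) = vertex-elim (λ j → f j ≡ extend κ (f w) j)
    (sym (extend-w κ (f w))) (λ i → trans (f∘ι≡κ i) (sym (extend-ι κ (f w) i)))

  extCount≡∑ : ∀ {m} (Γ : Graph m) κ → extCount Γ 𝕋 κ ≡ ∑[ u < m ] 𝟙 (IsExtension? Γ κ (extend κ u))
  extCount≡∑ Γ κ = countL-allFuns-determined (IsExtension? Γ κ)
    (λ f≗g (f-emb , f∘ι≡κ) → IsEmbedding-≗ {G = Θ} {H = Γ} f≗g f-emb , λ i → trans (sym (f≗g (ι i))) (f∘ι≡κ i))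
    w (extend κ) (extend-w κ) (extension-determined {Γ = Γ})

  extends⇔ : ∀ {m} {Γ : Graph m} {κ} u → IsEmbedding Δ Γ κ →
    IsExtension Γ κ (extend κ u) ⇔ ((∀ i → u ≢ κ i) × (∀ i → Adj Γ u (κ i) ⇔ Adj Θ w (ι i)))
  extends⇔ {m} {Γ} {κ} u (κ-inj , κ-adj) =
    mk⇔ restrict (λ (u∉κ , u-adj) → (injective u∉κ , adjacent u-adj) , extend-ι κ u)
    where
    e : Fin b → Fin m
    e = extend κ u
    toΓ : ∀ {j j′ v v′} → e j ≡ v → e j′ ≡ v′ → Adj Γ (e j) (e j′) → Adj Γ v v′
    toΓ refl refl adj = adj
    fromΓ : ∀ {j j′ v v′} → e j ≡ v → e j′ ≡ v′ → Adj Γ v v′ → Adj Γ (e j) (e j′)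
    fromΓ refl refl adj = adj
    restrict : IsExtension Γ κ e → (∀ i → u ≢ κ i) × (∀ i → Adj Γ u (κ i) ⇔ Adj Θ w (ι i))
    restrict ((e-inj , e-adj) , _) =
      (λ i u≡κi → w∉ι i (sym (e-inj w (ι i) (trans (extend-w κ u) (trans u≡κi (sym (extend-ι κ u i)))))))
      , λ i → mk⇔ (λ adj → proj₁ (e-adj w (ι i)) (fromΓ (extend-w κ u) (extend-ι κ u i) adj))
                  (λ adj → toΓ (extend-w κ u) (extend-ι κ u i) (proj₂ (e-adj w (ι i)) adj))
    injective : (∀ i → u ≢ κ i) → ∀ j j′ → e j ≡ e j′ → j ≡ j′
    injective u∉κ = vertex-elim (λ j → ∀ j′ → e j ≡ e j′ → j ≡ j′)
      (vertex-elim (λ j′ → e w ≡ e j′ → w ≡ j′) (λ _ → refl)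
        (λ i ew≡eιi → contradiction (trans (sym (extend-w κ u)) (trans ew≡eιi (extend-ι κ u i))) (u∉κ i)))
      (λ i → vertex-elim (λ j′ → e (ι i) ≡ e j′ → ι i ≡ j′)
        (λ eιi≡ew → contradiction (trans (sym (extend-w κ u)) (trans (sym eιi≡ew) (extend-ι κ u i))) (u∉κ i))
        (λ i′ eιi≡eιi′ → cong ι (κ-inj i i′ (trans (sym (extend-ι κ u i)) (trans eιi≡eιi′ (extend-ι κ u i′))))))
    adjacent : (∀ i → Adj Γ u (κ i) ⇔ Adj Θ w (ι i)) →
               ∀ j j′ → (Adj Γ (e j) (e j′) → Adj Θ j j′) × (Adj Θ j j′ → Adj Γ (e j) (e j′))
    adjacent u-adj = vertex-elim (λ j → ∀ j′ → Preserves j j′)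
      (vertex-elim (Preserves w)
        ((λ adj → contradiction adj (Adj-irrefl Γ)) , (λ adj → contradiction adj (Adj-irrefl Θ)))
        (λ i → (λ adj → to (u-adj i) (toΓ (extend-w κ u) (extend-ι κ u i) adj)) ,
               (λ adj → fromΓ (extend-w κ u) (extend-ι κ u i) (from (u-adj i) adj))))
      (λ i → vertex-elim (Preserves (ι i))
        ((λ adj → Adj-sym Θ (to (u-adj i) (toΓ (extend-w κ u) (extend-ι κ u i) (Adj-sym Γ adj)))) ,
         (λ adj → Adj-sym Γ (fromΓ (extend-w κ u) (extend-ι κ u i) (from (u-adj i) (Adj-sym Θ adj)))))
        (λ i′ → (λ adj → proj₂ (proj₂ ι-emb i i′) (proj₁ (κ-adj i i′) (toΓ (extend-ι κ u i) (extend-ι κ u i′) adj))) ,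
                (λ adj → fromΓ (extend-ι κ u i) (extend-ι κ u i′) (proj₂ (κ-adj i i′) (proj₁ (proj₂ ι-emb i i′) adj)))))
      where
      Preserves : Fin b → Fin b → Set
      Preserves j j′ = (Adj Γ (e j) (e j′) → Adj Θ j j′) × (Adj Θ j j′ → Adj Γ (e j) (e j′))

T-does⇔ : ∀ {A : Set} (a? : Dec A) → T (does a?) ⇔ A
T-does⇔ (yes a) = mk⇔ (λ _ → a) (λ _ → tt)
T-does⇔ (no ¬a) = mk⇔ (λ ()) ¬a

invariant⇒regular : ∀ {a b m} (Γ : Graph m) (T : GraphType a b) →
  (∀ κ κ′ → IsEmbedding (GraphType.Δ T) Γ κ → IsEmbedding (GraphType.Δ T) Γ κ′ → extCount Γ T κ ≡ extCount Γ T κ′) →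
  IsTRegular Γ T
invariant⇒regular {a} {m = m} Γ T invariant with Any.any? (IsEmbedding? Δ Γ) (allFuns a m)
  where open GraphType T
... | yes found = let κ₀ , κ₀-emb = Any.satisfied found in extCount Γ T κ₀ , λ κ κ-emb → invariant κ κ₀ κ-emb κ₀-emb
... | no  none  = 0 , λ κ κ-emb →
  contradiction (Any.map (λ g≗κ → IsEmbedding-≗ {G = GraphType.Δ T} {H = Γ} (sym ∘ g≗κ) κ-emb)
                         (allFuns-complete a m κ))
                none

module _ {n} (G H : Graph n) {f : Fin n → Fin n} (iso : IsIso G H f) where

  inverse : Fin n → Fin n
  inverse y = proj₁ (proj₂ iso y)

  inverse-∘ : ∀ x → inverse (f x) ≡ x
  inverse-∘ x = proj₁ (proj₁ iso) _ _ (proj₂ (proj₂ iso (f x)))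

  IsIso-inverse : IsIso H G inverse
  IsIso-inverse = (inverse-inj , inverse-adj) , λ x → f x , inverse-∘ x
    where
    f-adj : ∀ i j → (Adj H (f i) (f j) → Adj G i j) × (Adj G i j → Adj H (f i) (f j))
    f-adj = proj₂ (proj₁ iso)
    ∘-inverse : ∀ y → f (inverse y) ≡ y
    ∘-inverse y = proj₂ (proj₂ iso y)
    inverse-inj : ∀ y y′ → inverse y ≡ inverse y′ → y ≡ y′
    inverse-inj y y′ eq = trans (sym (∘-inverse y)) (trans (cong f eq) (∘-inverse y′))
    inverse-adj : ∀ y y′ → (Adj G (inverse y) (inverse y′) → Adj H y y′) × (Adj H y y′ → Adj G (inverse y) (inverse y′))
    inverse-adj y y′ =
      (λ adj → subst₂ (Adj H) (∘-inverse y) (∘-inverse y′) (proj₂ (f-adj (inverse y) (inverse y′)) adj)) ,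
      (λ adj → proj₁ (f-adj (inverse y) (inverse y′)) (subst₂ (Adj H) (sym (∘-inverse y)) (sym (∘-inverse y′)) adj))

IsIso-∘ : ∀ {n} {G H K : Graph n} {f g : Fin n → Fin n} → IsIso G H f → IsIso H K g → IsIso G K (g ∘ f)
IsIso-∘ {g = g} ((f-inj , f-adj) , f-surj) ((g-inj , g-adj) , g-surj) =
  ((λ i j eq → f-inj i j (g-inj _ _ eq)) ,
   (λ i j → (λ adj → proj₁ (f-adj i j) (proj₁ (g-adj _ _) adj)) ,
            (λ adj → proj₂ (g-adj _ _) (proj₂ (f-adj i j) adj)))) ,
  λ z → let (y , gy≡z) = g-surj z ; (x , fx≡y) = f-surj y in x , trans (cong g fx≡y) gy≡z

≅ᵀ-sym : ∀ {a b} {T₁ T₂ : GraphType a b} → T₁ ≅ᵀ T₂ → T₂ ≅ᵀ T₁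
≅ᵀ-sym {a} {b} {T₁} {T₂} (α , β , α-iso , β-iso , comm) =
  α⁻¹ , β⁻¹ , IsIso-inverse Δ₁ Δ₂ α-iso , IsIso-inverse Θ₁ Θ₂ β-iso , comm⁻¹
  where
  open GraphType T₁ renaming (Δ to Δ₁; Θ to Θ₁; ι to ι₁)
  open GraphType T₂ renaming (Δ to Δ₂; Θ to Θ₂; ι to ι₂)
  α⁻¹ : Fin a → Fin a
  α⁻¹ = inverse Δ₁ Δ₂ α-iso
  β⁻¹ : Fin b → Fin b
  β⁻¹ = inverse Θ₁ Θ₂ β-iso
  comm⁻¹ : ∀ i → β⁻¹ (ι₂ i) ≡ ι₁ (α⁻¹ i)
  comm⁻¹ i = begin
    β⁻¹ (ι₂ i)                ≡⟨ cong (β⁻¹ ∘ ι₂) (sym (proj₂ (proj₂ α-iso i))) ⟩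
    β⁻¹ (ι₂ (α (α⁻¹ i)))      ≡⟨ cong β⁻¹ (sym (comm (α⁻¹ i))) ⟩
    β⁻¹ (β (ι₁ (α⁻¹ i)))      ≡⟨ inverse-∘ Θ₁ Θ₂ β-iso (ι₁ (α⁻¹ i)) ⟩
    ι₁ (α⁻¹ i)                ∎
    where open ≡-Reasoning

≅ᵀ-trans : ∀ {a b} {T₁ T₂ T₃ : GraphType a b} → T₁ ≅ᵀ T₂ → T₂ ≅ᵀ T₃ → T₁ ≅ᵀ T₃
≅ᵀ-trans {T₃ = T₃} (α , β , α-iso , β-iso , comm) (α′ , β′ , α′-iso , β′-iso , comm′) =
  α′ ∘ α , β′ ∘ β , IsIso-∘ {K = GraphType.Δ T₃} α-iso α′-iso , IsIso-∘ {K = GraphType.Θ T₃} β-iso β′-iso ,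
  λ i → trans (cong β′ (comm i)) (comm′ (α i))

-- The Δ-part of an isomorphism of graph-types is forced by the Θ-part, since ι is an embedding.
≅ᵀ-fromΘ : ∀ {a b} (T₁ T₂ : GraphType a b) (α : Fin a → Fin a) (β : Fin b → Fin b) →
  IsIso (GraphType.Θ T₁) (GraphType.Θ T₂) β → (∀ i → β (GraphType.ι T₁ i) ≡ GraphType.ι T₂ (α i)) →
  (∀ i → ∃ λ i′ → α i′ ≡ i) → T₁ ≅ᵀ T₂
≅ᵀ-fromΘ T₁ T₂ α β β-iso@((β-inj , β-adj) , _) comm α-surj = α , β , ((α-inj , α-adj) , α-surj) , β-iso , comm
  where
  open GraphType T₁ renaming (Δ to Δ₁; Θ to Θ₁; ι to ι₁; ι-emb to ι₁-emb)
  open GraphType T₂ renaming (Δ to Δ₂; Θ to Θ₂; ι to ι₂; ι-emb to ι₂-emb)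
  α-inj : ∀ i j → α i ≡ α j → i ≡ j
  α-inj i j eq = proj₁ ι₁-emb i j (β-inj _ _ (trans (comm i) (trans (cong ι₂ eq) (sym (comm j)))))
  α-adj : ∀ i j → (Adj Δ₂ (α i) (α j) → Adj Δ₁ i j) × (Adj Δ₁ i j → Adj Δ₂ (α i) (α j))
  α-adj i j =
    (λ adj → proj₁ (proj₂ ι₁-emb i j) (proj₁ (β-adj (ι₁ i) (ι₁ j))
               (subst₂ (Adj Θ₂) (sym (comm i)) (sym (comm j)) (proj₂ (proj₂ ι₂-emb (α i) (α j)) adj)))) ,
    (λ adj → proj₁ (proj₂ ι₂-emb (α i) (α j))
               (subst₂ (Adj Θ₂) (comm i) (comm j) (proj₂ (β-adj (ι₁ i) (ι₁ j)) (proj₂ (proj₂ ι₁-emb i j) adj))))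

SingleEdge : Set → Set → Set → Set
SingleEdge A B C = (A × ¬ B × ¬ C) ⊎ (¬ A × B × ¬ C) ⊎ (¬ A × ¬ B × C)

SingleEdge-cong : ∀ {A B C A′ B′ C′ : Set} → A ⇔ A′ → B ⇔ B′ → C ⇔ C′ → SingleEdge A B C → SingleEdge A′ B′ C′
SingleEdge-cong A⇔ B⇔ C⇔ =
  Sum.map (λ (a , ¬b , ¬c) → to A⇔ a , ¬b ∘ from B⇔ , ¬c ∘ from C⇔)
    (Sum.map (λ (¬a , b , ¬c) → ¬a ∘ from A⇔ , to B⇔ b , ¬c ∘ from C⇔)
             (λ (¬a , ¬b , c) → ¬a ∘ from A⇔ , ¬b ∘ from B⇔ , to C⇔ c))

SingleEdge? : ∀ {A B C : Set} → Dec A → Dec B → Dec C → Dec (SingleEdge A B C)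
SingleEdge? a? b? c? =
  (a? ×-dec ¬? b? ×-dec ¬? c?) ⊎-dec (¬? a? ×-dec b? ×-dec ¬? c?) ⊎-dec (¬? a? ×-dec ¬? b? ×-dec c?)

tuple₄ : ∀ {A : Set} → A → A → A → A → Fin 4 → A
tuple₄ a b c d 0F = a
tuple₄ a b c d 1F = b
tuple₄ a b c d 2F = c
tuple₄ a b c d 3F = d

IsBijection : ∀ {n} → (Fin n → Fin n) → Set
IsBijection f = IsInjective f × (∀ y → ∃ λ x → f x ≡ y)

IsBijection? : ∀ {n} (f : Fin n → Fin n) → Dec (IsBijection f)
IsBijection? f = all? (λ i → all? (λ j → (f i ≟ f j) →-dec (i ≟ j))) ×-dec all? (λ y → any? (λ x → f x ≟ y))

-- Decided by evaluation; opaque, so that type checking its uses does not evaluate the decision again.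
opaque
  complete₄ : ∀ a b c → a ≢ b → a ≢ c → b ≢ c → ∃ λ d → IsBijection (tuple₄ a b c d)
  complete₄ = toWitness {a? = all? λ a → all? λ b → all? λ c →
    ¬? (a ≟ b) →-dec ¬? (a ≟ c) →-dec ¬? (b ≟ c) →-dec any? (λ d → IsBijection? (tuple₄ a b c d))} tt

bitsGraph : Bool → Bool → Bool → Bool → Bool → Bool → Graph 4
bitsGraph e₀₁ e₀₂ e₁₂ e₀₃ e₁₃ e₂₃ = edge
  where
  edge : Graph 4
  edge 0F 1F = e₀₁
  edge 0F 2F = e₀₂
  edge 1F 2F = e₁₂
  edge 0F 3F = e₀₃
  edge 1F 3F = e₁₃
  edge 2F 3F = e₂₃
  edge _  _  = false

fixLast : (Fin 3 → Fin 3) → Fin 4 → Fin 4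
fixLast α = tuple₄ (incl (α 0F)) (incl (α 1F)) (incl (α 2F)) 3F

IsoFixingLast : GraphType 3 4 → GraphType 3 4 → (Fin 3 → Fin 3) → Set
IsoFixingLast T₁ T₂ α =
  IsIso (GraphType.Δ T₁) (GraphType.Δ T₂) α × IsIso (GraphType.Θ T₁) (GraphType.Θ T₂) (fixLast α) ×
  (∀ i → fixLast α (GraphType.ι T₁ i) ≡ GraphType.ι T₂ (α i))

IsIso? : ∀ {a b} (G : Graph a) (H : Graph b) f → Dec (IsIso G H f)
IsIso? G H f = IsEmbedding? G H f ×-dec all? (λ y → any? (λ x → f x ≟ y))

IsoFixingLast? : ∀ T₁ T₂ α → Dec (IsoFixingLast T₁ T₂ α)
IsoFixingLast? T₁ T₂ α =
  IsIso? (GraphType.Δ T₁) (GraphType.Δ T₂) α ×-dec IsIso? (GraphType.Θ T₁) (GraphType.Θ T₂) (fixLast α) ×-dec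
  all? (λ i → fixLast α (GraphType.ι T₁ i) ≟ GraphType.ι T₂ (α i))

permutations₃ : List (Fin 3 → Fin 3)
permutations₃ = σ 0F 1F 2F ∷ σ 0F 2F 1F ∷ σ 1F 0F 2F ∷ σ 1F 2F 0F ∷ σ 2F 0F 1F ∷ σ 2F 1F 0F ∷ []
  where
  σ : Fin 3 → Fin 3 → Fin 3 → Fin 3 → Fin 3
  σ a b c 0F = a
  σ a b c 1F = b
  σ a b c 2F = c

∀-Bool? : {P : Bool → Set} → (∀ e → Dec (P e)) → Dec (∀ e → P e)
∀-Bool? P? = map′ (λ (pf , pt) → λ { false → pf ; true → pt }) (λ p → p false , p true) (P? false ×-dec P? true)

≅ᵀ-fromAny : ∀ T₁ T₂ {αs} → Any (IsoFixingLast T₁ T₂) αs → T₁ ≅ᵀ T₂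
≅ᵀ-fromAny T₁ T₂ found = let α , iso = Any.satisfied found in α , fixLast α , iso

Classified : Bool → Bool → Bool → Bool → Bool → Bool → Set
Classified e₀₁ e₀₂ e₁₂ e₀₃ e₁₃ e₂₃ = SingleEdge (T e₀₁) (T e₀₂) (T e₁₂) →
  ∃ λ k → Any (IsoFixingLast (exceptional k) (inducedType (bitsGraph e₀₁ e₀₂ e₁₂ e₀₃ e₁₃ e₂₃))) permutations₃

-- Exhaustive search over the 64 choices of edges and the six relabellings of Δ (opaque as complete₄).
opaque
  classified : ∀ e₀₁ e₀₂ e₁₂ e₀₃ e₁₃ e₂₃ → Classified e₀₁ e₀₂ e₁₂ e₀₃ e₁₃ e₂₃
  classified = toWitness {a? =
    ∀-Bool? λ e₀₁ → ∀-Bool? λ e₀₂ → ∀-Bool? λ e₁₂ → ∀-Bool? λ e₀₃ → ∀-Bool? λ e₁₃ → ∀-Bool? λ e₂₃ →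
    SingleEdge? (T? e₀₁) (T? e₀₂) (T? e₁₂) →-dec any? λ k →
    Any.any? (IsoFixingLast? (exceptional k) (inducedType (bitsGraph e₀₁ e₀₂ e₁₂ e₀₃ e₁₃ e₂₃))) permutations₃} tt

classification : ∀ e₀₁ e₀₂ e₁₂ e₀₃ e₁₃ e₂₃ → SingleEdge (T e₀₁) (T e₀₂) (T e₁₂) →
                 ∃ λ k → exceptional k ≅ᵀ inducedType (bitsGraph e₀₁ e₀₂ e₁₂ e₀₃ e₁₃ e₂₃)
classification e₀₁ e₀₂ e₁₂ e₀₃ e₁₃ e₂₃ single =
  let k , found = classified e₀₁ e₀₂ e₁₂ e₀₃ e₁₃ e₂₃ single
  in  k , ≅ᵀ-fromAny (exceptional k) (inducedType (bitsGraph e₀₁ e₀₂ e₁₂ e₀₃ e₁₃ e₂₃)) found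

-- Θ of a graph-type of order (3,4) is ι(Δ) plus one apex vertex; relabelling Θ so that the apex is 3 and
-- ι becomes the inclusion puts the graph-type into the form bitsGraph.
module Apex (𝕋 : GraphType 3 4) where

  open GraphType 𝕋

  private
    completion : ∃ λ d → IsBijection (tuple₄ (ι 0F) (ι 1F) (ι 2F) d)
    completion = complete₄ (ι 0F) (ι 1F) (ι 2F) (injective⇒≢ (proj₁ ι-emb) λ ())
                           (injective⇒≢ (proj₁ ι-emb) λ ()) (injective⇒≢ (proj₁ ι-emb) λ ())

  apex : Fin 4
  apex = proj₁ completion

  γ : Fin 4 → Fin 4
  γ = tuple₄ (ι 0F) (ι 1F) (ι 2F) apex

  γ-bijective : IsBijection γ
  γ-bijective = proj₂ completion

  γ-incl : ∀ i → γ (incl i) ≡ ι i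
  γ-incl 0F = refl
  γ-incl 1F = refl
  γ-incl 2F = refl

  apex∉ι : ∀ i → ι i ≢ apex
  apex∉ι i ιi≡apex = Fin.fromℕ≢inject₁ (sym (proj₁ γ-bijective (incl i) 3F (trans (γ-incl i) ιi≡apex)))

  apex-view : ∀ j → j ≡ apex ⊎ ∃ λ i → ι i ≡ j
  apex-view j with proj₂ γ-bijective j
  ... | 0F , γ0≡j = inj₂ (0F , γ0≡j)
  ... | 1F , γ1≡j = inj₂ (1F , γ1≡j)
  ... | 2F , γ2≡j = inj₂ (2F , γ2≡j)
  ... | 3F , γ3≡j = inj₁ (sym γ3≡j)

  bit : Fin 4 → Fin 4 → Bool
  bit a b = isYes (Adj? Θ (γ a) (γ b))

  normalGraph : Graph 4
  normalGraph = bitsGraph (bit 0F 1F) (bit 0F 2F) (bit 1F 2F) (bit 0F 3F) (bit 1F 3F) (bit 2F 3F)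

  private
    diagonal : ∀ {a} → Adj normalGraph a a ⇔ Adj Θ (γ a) (γ a)
    diagonal = mk⇔ (λ adj → contradiction adj (Adj-irrefl normalGraph)) (λ adj → contradiction adj (Adj-irrefl Θ))
    upper : ∀ {a b} → (a ≢ b × (T (bit a b) ⊎ T false)) ⇔ Adj Θ (γ a) (γ b)
    upper {a} {b} = mk⇔ (λ { (_ , inj₁ e) → toWitness {a? = Adj? Θ (γ a) (γ b)} e })
      (λ adj → (λ a≡b → proj₁ adj (cong γ a≡b)) , inj₁ (fromWitness {a? = Adj? Θ (γ a) (γ b)} adj))
    lower : ∀ {a b} → (a ≢ b × (T false ⊎ T (bit b a))) ⇔ Adj Θ (γ a) (γ b)
    lower {a} {b} = mk⇔ (λ { (_ , inj₂ e) → Adj-sym Θ (toWitness {a? = Adj? Θ (γ b) (γ a)} e) })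
      (λ adj → (λ a≡b → proj₁ adj (cong γ a≡b)) , inj₂ (fromWitness {a? = Adj? Θ (γ b) (γ a)} (Adj-sym Θ adj)))

  normalGraph-adj : ∀ a b → Adj normalGraph a b ⇔ Adj Θ (γ a) (γ b)
  normalGraph-adj 0F 0F = diagonal
  normalGraph-adj 0F 1F = upper
  normalGraph-adj 0F 2F = upper
  normalGraph-adj 0F 3F = upper
  normalGraph-adj 1F 0F = lower
  normalGraph-adj 1F 1F = diagonal
  normalGraph-adj 1F 2F = upper
  normalGraph-adj 1F 3F = upper
  normalGraph-adj 2F 0F = lower
  normalGraph-adj 2F 1F = lower
  normalGraph-adj 2F 2F = diagonal
  normalGraph-adj 2F 3F = upper
  normalGraph-adj 3F 0F = lower
  normalGraph-adj 3F 1F = lower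
  normalGraph-adj 3F 2F = lower
  normalGraph-adj 3F 3F = diagonal

  normal≅ᵀ : inducedType normalGraph ≅ᵀ 𝕋
  normal≅ᵀ = ≅ᵀ-fromΘ (inducedType normalGraph) 𝕋 (λ i → i) γ
    ((proj₁ γ-bijective , λ a b → let a⇔b = normalGraph-adj a b in from a⇔b , to a⇔b) , proj₂ γ-bijective)
    γ-incl (λ i → i , refl)

  Adj-ι⇔ : ∀ i j → T (isYes (Adj? Θ (ι i) (ι j))) ⇔ Adj Δ i j
  Adj-ι⇔ i j = mk⇔ (λ t → proj₁ (proj₂ ι-emb i j) (toWitness t)) (λ adj → fromWitness (proj₂ (proj₂ ι-emb i j) adj))

  single-edge⇒exceptional : SingleEdge (Adj Δ 0F 1F) (Adj Δ 0F 2F) (Adj Δ 1F 2F) → ∃ λ k → 𝕋 ≅ᵀ exceptional k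
  single-edge⇒exceptional single =
    let k , exceptional≅normal = classification (bit 0F 1F) (bit 0F 2F) (bit 1F 2F) (bit 0F 3F) (bit 1F 3F) (bit 2F 3F)
          (SingleEdge-cong (⇔.sym (Adj-ι⇔ 0F 1F)) (⇔.sym (Adj-ι⇔ 0F 2F)) (⇔.sym (Adj-ι⇔ 1F 2F)) single)
    in  k , ≅ᵀ-sym {T₁ = exceptional k} {T₂ = 𝕋}
                (≅ᵀ-trans {T₁ = exceptional k} {T₂ = inducedType normalGraph} {T₃ = 𝕋} exceptional≅normal normal≅ᵀ)

TriadsHaveCenters : IncidenceStructure → ℕ → Set
TriadsHaveCenters Π c = ∀ p q r → IsTriad Π p q r → centers Π p q r ≡ c

module PartialQuadrangle (Π : IncidenceStructure) {s t μ : ℕ} (PQ : IsPartialQuadrangle Π s t μ) where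

  open IncidenceStructure Π using (np)
  open IsPartialQuadrangle PQ
  open IsPartialLinearSpace pls

  Col : Point Π → Point Π → Set
  Col = Collinear Π

  Col? : ∀ p q → Dec (Col p q)
  Col? = Collinear? Π

  _I_ : Point Π → Line Π → Set
  _I_ = _on_ Π

  I? : ∀ p l → Dec (p I l)
  I? = on? Π

  Col-sym : ∀ {p q} → Col p q → Col q p
  Col-sym (p≢q , l , pl , ql) = (p≢q ∘ sym) , l , ql , pl

  on-line : ∀ {p q u l} → p ≢ q → p I l → q I l → Col u p → Col u q → u I l
  on-line {p} {q} {u} {l} p≢q pl ql up uq with triangles p q u (p≢q , l , pl , ql) (Col-sym uq) (Col-sym up)
  ... | l′ , pl′ , ql′ , ul′ = subst (u I_) (unique-line p q p≢q l′ l pl′ ql′ pl ql) ul′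

  degree : Point Π → ℕ
  degree p = ∑[ u < np ] 𝟙 (Col? u p)

  codegree : Point Π → Point Π → ℕ
  codegree p q = ∑[ u < np ] (𝟙 (Col? u p) * 𝟙 (Col? u q))

  codegree₃ : Point Π → Point Π → Point Π → ℕ
  codegree₃ p q r = ∑[ u < np ] (𝟙 (Col? u p) * (𝟙 (Col? u q) * 𝟙 (Col? u r)))

  line-size-except : ∀ {p l} → p I l → ∑[ u < np ] (𝟙 (¬? (u ≟ p)) * 𝟙 (I? u l)) ≡ s
  line-size-except {p} {l} pl = suc-injective (begin
    suc others                           ≡⟨ +-comm 1 others ⟩
    others + 1                           ≡⟨ cong (others +_) (sym (𝟙-yes pl (I? p l))) ⟩
    others + 𝟙 (I? p l)                  ≡⟨ sym (∑-remove p (λ u → 𝟙 (I? u l))) ⟩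
    ∑[ u < np ] 𝟙 (I? u l)               ≡⟨ sym (count≡∑𝟙 (λ u → I? u l)) ⟩
    count (λ u → I? u l)                 ≡⟨ line-size l ⟩
    suc s                                ∎)
    where
    open ≡-Reasoning
    others : ℕ
    others = ∑[ u < np ] (𝟙 (¬? (u ≟ p)) * 𝟙 (I? u l))

  degree≡ : ∀ p → degree p ≡ suc t * s
  degree≡ p = begin
    ∑[ u < np ] 𝟙 (Col? u p)                   ≡⟨ sum-cong-≗ (λ u → 𝟙-cong (through u) (Col? u p) (any? (Q? u))) ⟩
    ∑[ u < np ] 𝟙 (any? (Q? u))                ≡⟨ sum-cong-≗ (λ u → 𝟙-any?-unique (Q? u) (unique u)) ⟩
    ∑[ u < np ] ∑[ l < nl ] 𝟙 (Q? u l)         ≡⟨ ∑-comm (λ u l → 𝟙 (Q? u l)) ⟩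
    ∑[ l < nl ] ∑[ u < np ] 𝟙 (Q? u l)         ≡⟨ sum-cong-≗ (λ l → sum-cong-≗ (λ u → 𝟙-Q? u l)) ⟩
    ∑[ l < nl ] ∑[ u < np ] (𝟙 (I? p l) * others l u)
                                               ≡⟨ sum-cong-≗ (λ l → sym (*-distribˡ-sum (𝟙 (I? p l)) (others l))) ⟩
    ∑[ l < nl ] (𝟙 (I? p l) * sum (others l))  ≡⟨ sum-cong-≗ others-on ⟩
    ∑[ l < nl ] (𝟙 (I? p l) * s)               ≡⟨ sym (*-distribʳ-sum s (λ l → 𝟙 (I? p l))) ⟩
    ∑[ l < nl ] 𝟙 (I? p l) * s                 ≡⟨ cong (_* s) (trans (sym (count≡∑𝟙 (I? p))) (point-deg p)) ⟩
    suc t * s                                  ∎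
    where
    open ≡-Reasoning
    open IncidenceStructure Π using (nl)
    Q : Point Π → Line Π → Set
    Q u l = p I l × u ≢ p × u I l
    Q? : ∀ u l → Dec (Q u l)
    Q? u l = I? p l ×-dec ¬? (u ≟ p) ×-dec I? u l
    through : ∀ u → Col u p ⇔ ∃ (Q u)
    through u = mk⇔ (λ (u≢p , l , ul , pl) → l , pl , u≢p , ul) (λ (l , pl , u≢p , ul) → u≢p , l , ul , pl)
    unique : ∀ u l l′ → Q u l → Q u l′ → l ≡ l′
    unique u l l′ (pl , u≢p , ul) (pl′ , _ , ul′) = unique-line u p u≢p l l′ ul pl ul′ pl′
    others : Line Π → Point Π → ℕ
    others l u = 𝟙 (¬? (u ≟ p)) * 𝟙 (I? u l)
    𝟙-Q? : ∀ u l → 𝟙 (Q? u l) ≡ 𝟙 (I? p l) * others l u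
    𝟙-Q? u l = 𝟙-×₃ (I? p l) (¬? (u ≟ p)) (I? u l)
    others-on : ∀ l → 𝟙 (I? p l) * sum (others l) ≡ 𝟙 (I? p l) * s
    others-on l with I? p l
    ... | yes pl = cong (_+ 0) (line-size-except pl)
    ... | no  _  = refl

  codegree-collinear : ∀ {p q} → Col p q → suc (codegree p q) ≡ s
  codegree-collinear {p} {q} pq@(p≢q , L , pL , qL) = sym (begin
    s                                                         ≡⟨ sym (line-size-except pL) ⟩
    sum f                                                     ≡⟨ ∑-remove q f ⟩
    ∑[ u < np ] (𝟙 (¬? (u ≟ q)) * f u) + f q                  ≡⟨ cong₂ _+_ (sum-cong-≗ common) f-q ⟩
    codegree p q + 1                                          ≡⟨ +-comm (codegree p q) 1 ⟩
    suc (codegree p q)                                        ∎)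
    where
    open ≡-Reasoning
    f : Point Π → ℕ
    f u = 𝟙 (¬? (u ≟ p)) * 𝟙 (I? u L)
    f-q : f q ≡ 1
    f-q = cong₂ _*_ (𝟙-yes (p≢q ∘ sym) (¬? (q ≟ p))) (𝟙-yes qL (I? q L))
    common : ∀ u → 𝟙 (¬? (u ≟ q)) * f u ≡ 𝟙 (Col? u p) * 𝟙 (Col? u q)
    common u = begin
      𝟙 (¬? (u ≟ q)) * (𝟙 (¬? (u ≟ p)) * 𝟙 (I? u L))    ≡⟨ sym (𝟙-×₃ (¬? (u ≟ q)) (¬? (u ≟ p)) (I? u L)) ⟩
      𝟙 on-L?                                           ≡⟨ 𝟙-cong on-L⇔ on-L? (Col? u p ×-dec Col? u q) ⟩
      𝟙 (Col? u p ×-dec Col? u q)                       ≡⟨ 𝟙-× (Col? u p) (Col? u q) ⟩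
      𝟙 (Col? u p) * 𝟙 (Col? u q)                       ∎
      where
      on-L? : Dec (u ≢ q × u ≢ p × u I L)
      on-L? = ¬? (u ≟ q) ×-dec ¬? (u ≟ p) ×-dec I? u L
      on-L⇔ : (u ≢ q × u ≢ p × u I L) ⇔ (Col u p × Col u q)
      on-L⇔ = mk⇔ (λ (u≢q , u≢p , uL) → (u≢p , L , uL , pL) , (u≢q , L , uL , qL))
                  (λ (up , uq) → proj₁ uq , proj₁ up , on-line p≢q pL qL up uq)

  codegree-nonCollinear : ∀ {p q} → p ≢ q → ¬ Col p q → codegree p q ≡ μ
  codegree-nonCollinear {p} {q} p≢q ¬pq = begin
    ∑[ u < np ] (𝟙 (Col? u p) * 𝟙 (Col? u q))       ≡⟨ sum-cong-≗ (λ u → sym (𝟙-× (Col? u p) (Col? u q))) ⟩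
    ∑[ u < np ] 𝟙 (Col? u p ×-dec Col? u q)         ≡⟨ sum-cong-≗ (λ u → 𝟙-cong swap (Col? u p ×-dec Col? u q) (both? u)) ⟩
    ∑[ u < np ] 𝟙 (both? u)                         ≡⟨ sym (count≡∑𝟙 both?) ⟩
    count both?                                     ≡⟨ mu p q p≢q ¬pq ⟩
    μ                                               ∎
    where
    open ≡-Reasoning
    both? : ∀ u → Dec (Col p u × Col q u)
    both? u = Col? p u ×-dec Col? q u
    swap : ∀ {u} → (Col u p × Col u q) ⇔ (Col p u × Col q u)
    swap = mk⇔ (λ (up , uq) → Col-sym up , Col-sym uq) (λ (pu , qu) → Col-sym pu , Col-sym qu)

  codegree-cong : ∀ {p q p′ q′} → p ≢ q → p′ ≢ q′ → Col p q ⇔ Col p′ q′ → codegree p q ≡ codegree p′ q′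
  codegree-cong {p} {q} p≢q p′≢q′ pq⇔ with Col? p q
  ... | yes pq = suc-injective (trans (codegree-collinear pq) (sym (codegree-collinear (to pq⇔ pq))))
  ... | no ¬pq = trans (codegree-nonCollinear p≢q ¬pq) (sym (codegree-nonCollinear p′≢q′ (¬pq ∘ from pq⇔)))

  codegree₃-triangle : ∀ {p q r} → Col p q → Col q r → Col p r → suc (codegree₃ p q r) ≡ codegree p q
  codegree₃-triangle {p} {q} {r} pq qr pr with triangles p q r pq qr pr
  ... | L , pL , qL , rL = sym (begin
    codegree p q                                        ≡⟨ ∑-remove r g ⟩
    ∑[ u < np ] (𝟙 (¬? (u ≟ r)) * g u) + g r            ≡⟨ cong₂ _+_ (sum-cong-≗ common) g-r ⟩
    codegree₃ p q r + 1                                 ≡⟨ +-comm (codegree₃ p q r) 1 ⟩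
    suc (codegree₃ p q r)                               ∎)
    where
    open ≡-Reasoning
    g : Point Π → ℕ
    g u = 𝟙 (Col? u p) * 𝟙 (Col? u q)
    g-r : g r ≡ 1
    g-r = cong₂ _*_ (𝟙-yes (Col-sym pr) (Col? r p)) (𝟙-yes (Col-sym qr) (Col? r q))
    common : ∀ u → 𝟙 (¬? (u ≟ r)) * g u ≡ 𝟙 (Col? u p) * (𝟙 (Col? u q) * 𝟙 (Col? u r))
    common u = begin
      𝟙 (¬? (u ≟ r)) * (𝟙 (Col? u p) * 𝟙 (Col? u q))     ≡⟨ sym (𝟙-×₃ (¬? (u ≟ r)) (Col? u p) (Col? u q)) ⟩
      𝟙 (¬? (u ≟ r) ×-dec Col? u p ×-dec Col? u q)       ≡⟨ 𝟙-cong third (¬? (u ≟ r) ×-dec Col? u p ×-dec Col? u q) all-three? ⟩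
      𝟙 all-three?                                       ≡⟨ 𝟙-×₃ (Col? u p) (Col? u q) (Col? u r) ⟩
      𝟙 (Col? u p) * (𝟙 (Col? u q) * 𝟙 (Col? u r))       ∎
      where
      all-three? : Dec (Col u p × Col u q × Col u r)
      all-three? = Col? u p ×-dec Col? u q ×-dec Col? u r
      third : (u ≢ r × Col u p × Col u q) ⇔ (Col u p × Col u q × Col u r)
      third = mk⇔ (λ (u≢r , up , uq) → up , uq , (u≢r , L , on-line (proj₁ pq) pL qL up uq , rL))
                  (λ (up , uq , ur) → proj₁ ur , up , uq)

  codegree₃-none : ∀ {p q r} → (∀ u → ¬ (Col u p × Col u q × Col u r)) → codegree₃ p q r ≡ 0
  codegree₃-none {p} {q} {r} none = trans (sum-cong-≗ nothing) (sum-replicate-zero np)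
    where
    nothing : ∀ u → 𝟙 (Col? u p) * (𝟙 (Col? u q) * 𝟙 (Col? u r)) ≡ 0
    nothing u = trans (sym (𝟙-×₃ (Col? u p) (Col? u q) (Col? u r)))
                      (𝟙-no (none u) (Col? u p ×-dec Col? u q ×-dec Col? u r))

  path-no-common-neighbour : ∀ {p q r} → p ≢ r → Col p q → Col q r → ¬ Col p r → ∀ u → ¬ (Col u p × Col u q × Col u r)
  path-no-common-neighbour {p} {q} {r} p≢r (p≢q , l , pl , ql) (q≢r , l′ , ql′ , rl′) ¬pr u (up , uq , ur) =
    ¬pr (p≢r , l′ , subst (p I_) l≡l′ pl , rl′)
    where
    l≡l′ : l ≡ l′
    l≡l′ = unique-line u q (proj₁ uq) l l′ (on-line p≢q pl ql up uq) ql (on-line q≢r ql′ rl′ uq ur) ql′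

  codegree₃≡centers : ∀ p q r → codegree₃ p q r ≡ centers Π p q r
  codegree₃≡centers p q r = sym (trans (count≡∑𝟙 (λ u → Col? u p ×-dec Col? u q ×-dec Col? u r))
                                       (sum-cong-≗ (λ u → 𝟙-×₃ (Col? u p) (Col? u q) (Col? u r))))

  Triple : Set
  Triple = Fin 3 → Point Π

  SamePattern : Triple → Triple → Set
  SamePattern κ κ′ = ∀ i j → Col (κ i) (κ j) ⇔ Col (κ′ i) (κ′ j)

  SingleEdgeTriple : Triple → Set
  SingleEdgeTriple κ = SingleEdge (Col (κ 0F) (κ 1F)) (Col (κ 0F) (κ 2F)) (Col (κ 1F) (κ 2F))

  module _ (κ : Triple) (κ-inj : IsInjective κ) where

    codegree₃-path₀ : Col (κ 0F) (κ 1F) → Col (κ 0F) (κ 2F) → ¬ Col (κ 1F) (κ 2F) → codegree₃ (κ 0F) (κ 1F) (κ 2F) ≡ 0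
    codegree₃-path₀ c01 c02 ¬c12 = codegree₃-none λ u (u0 , u1 , u2) →
      path-no-common-neighbour (injective⇒≢ κ-inj λ ()) (Col-sym c01) c02 ¬c12 u (u1 , u0 , u2)

    codegree₃-path₁ : Col (κ 0F) (κ 1F) → Col (κ 1F) (κ 2F) → ¬ Col (κ 0F) (κ 2F) → codegree₃ (κ 0F) (κ 1F) (κ 2F) ≡ 0
    codegree₃-path₁ c01 c12 ¬c02 = codegree₃-none (path-no-common-neighbour (injective⇒≢ κ-inj λ ()) c01 c12 ¬c02)

    codegree₃-path₂ : Col (κ 0F) (κ 2F) → Col (κ 1F) (κ 2F) → ¬ Col (κ 0F) (κ 1F) → codegree₃ (κ 0F) (κ 1F) (κ 2F) ≡ 0
    codegree₃-path₂ c02 c12 ¬c01 = codegree₃-none λ u (u0 , u1 , u2) →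
      path-no-common-neighbour (injective⇒≢ κ-inj λ ()) c02 (Col-sym c12) ¬c01 u (u0 , u2 , u1)

    codegree₃-triad : ∀ {c} → TriadsHaveCenters Π c →
      ¬ Col (κ 0F) (κ 1F) → ¬ Col (κ 0F) (κ 2F) → ¬ Col (κ 1F) (κ 2F) → codegree₃ (κ 0F) (κ 1F) (κ 2F) ≡ c
    codegree₃-triad triad-centers ¬c01 ¬c02 ¬c12 = trans (codegree₃≡centers _ _ _) (triad-centers _ _ _
      ((injective⇒≢ κ-inj (λ ()) , injective⇒≢ κ-inj (λ ()) , injective⇒≢ κ-inj (λ ())) , ¬c01 , ¬c12 , ¬c02))

    codegree₃-line : Col (κ 0F) (κ 1F) → Col (κ 0F) (κ 2F) → Col (κ 1F) (κ 2F) →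
                     suc (suc (codegree₃ (κ 0F) (κ 1F) (κ 2F))) ≡ s
    codegree₃-line c01 c02 c12 = trans (cong suc (codegree₃-triangle c01 c12 c02)) (codegree-collinear c01)

  codegree₃-cong : ∀ {c} → TriadsHaveCenters Π c →
    ∀ {κ κ′} → IsInjective κ → IsInjective κ′ → SamePattern κ κ′ → ¬ SingleEdgeTriple κ →
    codegree₃ (κ 0F) (κ 1F) (κ 2F) ≡ codegree₃ (κ′ 0F) (κ′ 1F) (κ′ 2F)
  codegree₃-cong triad-centers {κ} {κ′} κ-inj κ′-inj same ¬single =
    by-pattern (Col? (κ 0F) (κ 1F)) (Col? (κ 0F) (κ 2F)) (Col? (κ 1F) (κ 2F))
    where
    c′ : ∀ {i j} → Col (κ i) (κ j) → Col (κ′ i) (κ′ j)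
    c′ = to (same _ _)
    ¬c′ : ∀ {i j} → ¬ Col (κ i) (κ j) → ¬ Col (κ′ i) (κ′ j)
    ¬c′ ¬c = ¬c ∘ from (same _ _)
    by-pattern : Dec (Col (κ 0F) (κ 1F)) → Dec (Col (κ 0F) (κ 2F)) → Dec (Col (κ 1F) (κ 2F)) →
                 codegree₃ (κ 0F) (κ 1F) (κ 2F) ≡ codegree₃ (κ′ 0F) (κ′ 1F) (κ′ 2F)
    by-pattern (yes c01) (yes c02) (yes c12) =
      suc-injective (suc-injective (trans (codegree₃-line κ κ-inj c01 c02 c12)
                                          (sym (codegree₃-line κ′ κ′-inj (c′ c01) (c′ c02) (c′ c12)))))
    by-pattern (yes c01) (yes c02) (no ¬c12) =
      trans (codegree₃-path₀ κ κ-inj c01 c02 ¬c12) (sym (codegree₃-path₀ κ′ κ′-inj (c′ c01) (c′ c02) (¬c′ ¬c12)))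
    by-pattern (yes c01) (no ¬c02) (yes c12) =
      trans (codegree₃-path₁ κ κ-inj c01 c12 ¬c02) (sym (codegree₃-path₁ κ′ κ′-inj (c′ c01) (c′ c12) (¬c′ ¬c02)))
    by-pattern (no ¬c01) (yes c02) (yes c12) =
      trans (codegree₃-path₂ κ κ-inj c02 c12 ¬c01) (sym (codegree₃-path₂ κ′ κ′-inj (c′ c02) (c′ c12) (¬c′ ¬c01)))
    by-pattern (yes c01) (no ¬c02) (no ¬c12) = contradiction (inj₁ (c01 , ¬c02 , ¬c12)) ¬single
    by-pattern (no ¬c01) (yes c02) (no ¬c12) = contradiction (inj₂ (inj₁ (¬c01 , c02 , ¬c12))) ¬single
    by-pattern (no ¬c01) (no ¬c02) (yes c12) = contradiction (inj₂ (inj₂ (¬c01 , ¬c02 , c12))) ¬single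
    by-pattern (no ¬c01) (no ¬c02) (no ¬c12) =
      trans (codegree₃-triad κ κ-inj triad-centers ¬c01 ¬c02 ¬c12)
            (sym (codegree₃-triad κ′ κ′-inj triad-centers (¬c′ ¬c01) (¬c′ ¬c02) (¬c′ ¬c12)))

  weight : Literal → Literal → Literal → Triple → Point Π → ℕ
  weight a b d κ u = 𝟙 (⟦ a ⟧? (Col? u (κ 0F))) * (𝟙 (⟦ b ⟧? (Col? u (κ 1F))) * 𝟙 (⟦ d ⟧? (Col? u (κ 2F))))

  Satisfies : Literal → Literal → Literal → Triple → Point Π → Set
  Satisfies a b d κ u = ⟦ a ⟧ (Col u (κ 0F)) × ⟦ b ⟧ (Col u (κ 1F)) × ⟦ d ⟧ (Col u (κ 2F))

  Satisfies? : ∀ a b d κ u → Dec (Satisfies a b d κ u)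
  Satisfies? a b d κ u = ⟦ a ⟧? (Col? u (κ 0F)) ×-dec ⟦ b ⟧? (Col? u (κ 1F)) ×-dec ⟦ d ⟧? (Col? u (κ 2F))

  𝟙-Satisfies : ∀ a b d κ u → 𝟙 (Satisfies? a b d κ u) ≡ weight a b d κ u
  𝟙-Satisfies a b d κ u = 𝟙-×₃ (⟦ a ⟧? (Col? u (κ 0F))) (⟦ b ⟧? (Col? u (κ 1F))) (⟦ d ⟧? (Col? u (κ 2F)))

  patternCount : Triple → Literal → Literal → Literal → ℕ
  patternCount κ a b d = ∑[ u < np ] weight a b d κ u

  module _ (κ : Triple) (u : Point Π) where

    weight-split₀ : ∀ b d → weight free b d κ u ≡ weight pos b d κ u + weight neg b d κ u
    weight-split₀ b d = linear-free (Col? u (κ 0F)) (_* r) (λ m n → *-distribʳ-+ r m n)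
      where r : ℕ
            r = 𝟙 (⟦ b ⟧? (Col? u (κ 1F))) * 𝟙 (⟦ d ⟧? (Col? u (κ 2F)))

    weight-split₁ : ∀ a d → weight a free d κ u ≡ weight a pos d κ u + weight a neg d κ u
    weight-split₁ a d = linear-free (Col? u (κ 1F)) (λ m → f₀ * (m * f₂))
      (λ m n → trans (cong (f₀ *_) (*-distribʳ-+ f₂ m n)) (*-distribˡ-+ f₀ (m * f₂) (n * f₂)))
      where f₀ f₂ : ℕ
            f₀ = 𝟙 (⟦ a ⟧? (Col? u (κ 0F)))
            f₂ = 𝟙 (⟦ d ⟧? (Col? u (κ 2F)))

    weight-split₂ : ∀ a b → weight a b free κ u ≡ weight a b pos κ u + weight a b neg κ u
    weight-split₂ a b = linear-free (Col? u (κ 2F)) (λ m → f₀ * (f₁ * m))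
      (λ m n → trans (cong (f₀ *_) (*-distribˡ-+ f₁ m n)) (*-distribˡ-+ f₀ (f₁ * m) (f₁ * n)))
      where f₀ f₁ : ℕ
            f₀ = 𝟙 (⟦ a ⟧? (Col? u (κ 0F)))
            f₁ = 𝟙 (⟦ b ⟧? (Col? u (κ 1F)))

  patternCount-additive : ∀ κ → Additive (patternCount κ)
  patternCount-additive κ = record
    { split₀ = λ b d → ∑-split (λ u → weight-split₀ κ u b d)
    ; split₁ = λ a d → ∑-split (λ u → weight-split₁ κ u a d)
    ; split₂ = λ a b → ∑-split (λ u → weight-split₂ κ u a b)
    }

  outsideCount : Triple → Literal → Literal → Literal → ℕ
  outsideCount κ a b d = ∑[ u < np ] (𝟙 (u ∉? κ) * weight a b d κ u)

  module _ {c} (triad-centers : TriadsHaveCenters Π c)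
           {κ κ′ : Triple} (κ-inj : IsInjective κ) (κ′-inj : IsInjective κ′) (same : SamePattern κ κ′) where

    degree-cong : ∀ i → degree (κ i) ≡ degree (κ′ i)
    degree-cong i = trans (degree≡ (κ i)) (sym (degree≡ (κ′ i)))

    codegree-cong-at : ∀ i j → i ≢ j → codegree (κ i) (κ j) ≡ codegree (κ′ i) (κ′ j)
    codegree-cong-at i j i≢j = codegree-cong (injective⇒≢ κ-inj i≢j) (injective⇒≢ κ′-inj i≢j) (same i j)

    nbr : Fin 3 → Triple → Point Π → ℕ
    nbr i κ u = 𝟙 (Col? u (κ i))

    nbr₂ : Fin 3 → Fin 3 → Triple → Point Π → ℕ
    nbr₂ i j κ u = nbr i κ u * nbr j κ u

    reshape : ∀ a b d (f : Triple → Point Π → ℕ) → (∀ κ u → weight a b d κ u ≡ f κ u) →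
              sum (f κ) ≡ sum (f κ′) → patternCount κ a b d ≡ patternCount κ′ a b d
    reshape a b d f w≡f sums≡ = trans (sum-cong-≗ (w≡f κ)) (trans sums≡ (sym (sum-cong-≗ (w≡f κ′))))

    patternCount-positive-cong : ¬ SingleEdgeTriple κ → ∀ a b d → Positive a → Positive b → Positive d →
      patternCount κ a b d ≡ patternCount κ′ a b d
    patternCount-positive-cong ¬single free free free _ _ _ = refl
    patternCount-positive-cong ¬single pos  free free _ _ _ =
      reshape pos free free (nbr 0F) (λ _ _ → *-identityʳ _) (degree-cong 0F)
    patternCount-positive-cong ¬single free pos  free _ _ _ =
      reshape free pos free (nbr 1F) (λ _ _ → trans (*-identityˡ _) (*-identityʳ _)) (degree-cong 1F)
    patternCount-positive-cong ¬single free free pos  _ _ _ =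
      reshape free free pos (nbr 2F) (λ _ _ → trans (*-identityˡ _) (*-identityˡ _)) (degree-cong 2F)
    patternCount-positive-cong ¬single pos  pos  free _ _ _ =
      reshape pos pos free (nbr₂ 0F 1F) (λ κ u → cong (nbr 0F κ u *_) (*-identityʳ _)) (codegree-cong-at 0F 1F λ ())
    patternCount-positive-cong ¬single pos  free pos  _ _ _ =
      reshape pos free pos (nbr₂ 0F 2F) (λ κ u → cong (nbr 0F κ u *_) (*-identityˡ _)) (codegree-cong-at 0F 2F λ ())
    patternCount-positive-cong ¬single free pos  pos  _ _ _ =
      reshape free pos pos (nbr₂ 1F 2F) (λ _ _ → *-identityˡ _) (codegree-cong-at 1F 2F λ ())
    patternCount-positive-cong ¬single pos  pos  pos  _ _ _ =
      codegree₃-cong triad-centers κ-inj κ′-inj same ¬single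

    patternCount-cong : ¬ SingleEdgeTriple κ → ∀ a b d → patternCount κ a b d ≡ patternCount κ′ a b d
    patternCount-cong ¬single = additive-≡ (patternCount-additive κ) (patternCount-additive κ′)
                                           (patternCount-positive-cong ¬single)

    weight-at-cong : ∀ a b d i → weight a b d κ (κ i) ≡ weight a b d κ′ (κ′ i)
    weight-at-cong a b d i =
      cong₂ _*_ (literal-cong a 0F) (cong₂ _*_ (literal-cong b 1F) (literal-cong d 2F))
      where
      literal-cong : ∀ ℓ j → 𝟙 (⟦ ℓ ⟧? (Col? (κ i) (κ j))) ≡ 𝟙 (⟦ ℓ ⟧? (Col? (κ′ i) (κ′ j)))
      literal-cong ℓ j = 𝟙-cong (⟦ ℓ ⟧-cong (same i j)) (⟦ ℓ ⟧? (Col? (κ i) (κ j))) (⟦ ℓ ⟧? (Col? (κ′ i) (κ′ j)))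

    outsideCount-cong : ¬ SingleEdgeTriple κ → ∀ a b d → outsideCount κ a b d ≡ outsideCount κ′ a b d
    outsideCount-cong ¬single a b d = +-cancelʳ-≡ (atκ κ) (outsideCount κ a b d) (outsideCount κ′ a b d) (begin
      outsideCount κ a b d + atκ κ      ≡⟨ sym (∑-image κ κ-inj (weight a b d κ)) ⟩
      patternCount κ a b d              ≡⟨ patternCount-cong ¬single a b d ⟩
      patternCount κ′ a b d             ≡⟨ ∑-image κ′ κ′-inj (weight a b d κ′) ⟩
      outsideCount κ′ a b d + atκ κ′    ≡⟨ cong (outsideCount κ′ a b d +_) (sym (sum-cong-≗ (weight-at-cong a b d))) ⟩
      outsideCount κ′ a b d + atκ κ     ∎)
      where
      open ≡-Reasoning
      atκ : Triple → ℕ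
      atκ τ = ∑[ i < 3 ] weight a b d τ (τ i)

  Γ : Graph np
  Γ = pointGraph Π

  Adj⇔Col : ∀ {p q} → Adj Γ p q ⇔ Col p q
  Adj⇔Col {p} {q} = mk⇔
    (λ { (_ , inj₁ t) → to (T-does⇔ (Col? p q)) t ; (_ , inj₂ t) → Col-sym (to (T-does⇔ (Col? q p)) t) })
    (λ pq → proj₁ pq , inj₁ (from (T-does⇔ (Col? p q)) pq))

  module _ (𝕋 : GraphType 3 4) where

    open GraphType 𝕋
    open Apex 𝕋
    open OneVertexExtension 𝕋 apex apex∉ι apex-view

    apexLiteral : Fin 3 → Literal
    apexLiteral i = literal (Adj? Θ apex (ι i))

    ℓ₀ ℓ₁ ℓ₂ : Literal
    ℓ₀ = apexLiteral 0F
    ℓ₁ = apexLiteral 1F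
    ℓ₂ = apexLiteral 2F

    Col⇔Δ : ∀ {κ} → IsEmbedding Δ Γ κ → ∀ i j → Col (κ i) (κ j) ⇔ Adj Δ i j
    Col⇔Δ (_ , κ-adj) i j = ⇔.trans (⇔.sym Adj⇔Col) (mk⇔ (proj₁ (κ-adj i j)) (proj₂ (κ-adj i j)))

    extCount≡outsideCount : ∀ κ → IsEmbedding Δ Γ κ → extCount Γ 𝕋 κ ≡ outsideCount κ ℓ₀ ℓ₁ ℓ₂
    extCount≡outsideCount κ κ-emb = trans (extCount≡∑ Γ κ) (sum-cong-≗ λ u → begin
      𝟙 (IsExtension? Γ κ (extend κ u))         ≡⟨ 𝟙-cong (extension⇔ u) (IsExtension? Γ κ (extend κ u)) (eligible? u) ⟩
      𝟙 (eligible? u)                           ≡⟨ 𝟙-× (u ∉? κ) (Satisfies? ℓ₀ ℓ₁ ℓ₂ κ u) ⟩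
      𝟙 (u ∉? κ) * 𝟙 (Satisfies? ℓ₀ ℓ₁ ℓ₂ κ u)  ≡⟨ cong (𝟙 (u ∉? κ) *_) (𝟙-Satisfies ℓ₀ ℓ₁ ℓ₂ κ u) ⟩
      𝟙 (u ∉? κ) * weight ℓ₀ ℓ₁ ℓ₂ κ u          ∎)
      where
      open ≡-Reasoning
      eligible? : ∀ u → Dec ((∀ i → u ≢ κ i) × Satisfies ℓ₀ ℓ₁ ℓ₂ κ u)
      eligible? u = u ∉? κ ×-dec Satisfies? ℓ₀ ℓ₁ ℓ₂ κ u
      literal⇔ : ∀ u i → (Adj Γ u (κ i) ⇔ Adj Θ apex (ι i)) ⇔ ⟦ apexLiteral i ⟧ (Col u (κ i))
      literal⇔ u i = ⇔.trans (mk⇔ (⇔.trans (⇔.sym Adj⇔Col)) (⇔.trans Adj⇔Col)) (⇔.sym (⟦literal⟧ (Adj? Θ apex (ι i))))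
      extension⇔ : ∀ u → IsExtension Γ κ (extend κ u) ⇔ ((∀ i → u ≢ κ i) × Satisfies ℓ₀ ℓ₁ ℓ₂ κ u)
      extension⇔ u = ⇔.trans (extends⇔ {Γ = Γ} u κ-emb) (mk⇔
        (λ (u∉κ , adj⇔) → u∉κ , to (literal⇔ u 0F) (adj⇔ 0F) , to (literal⇔ u 1F) (adj⇔ 1F) ,
                                to (literal⇔ u 2F) (adj⇔ 2F))
        (λ (u∉κ , l₀ , l₁ , l₂) → u∉κ , λ { 0F → from (literal⇔ u 0F) l₀
                                          ; 1F → from (literal⇔ u 1F) l₁
                                          ; 2F → from (literal⇔ u 2F) l₂ }))

    extCount-cong : ∀ {c} → TriadsHaveCenters Π c → ¬ SingleEdge (Adj Δ 0F 1F) (Adj Δ 0F 2F) (Adj Δ 1F 2F) →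
      ∀ κ κ′ → IsEmbedding Δ Γ κ → IsEmbedding Δ Γ κ′ → extCount Γ 𝕋 κ ≡ extCount Γ 𝕋 κ′
    extCount-cong triad-centers ¬single κ κ′ κ-emb κ′-emb = begin
      extCount Γ 𝕋 κ              ≡⟨ extCount≡outsideCount κ κ-emb ⟩
      outsideCount κ ℓ₀ ℓ₁ ℓ₂     ≡⟨ outsideCount-cong triad-centers (proj₁ κ-emb) (proj₁ κ′-emb) same ¬single′ ℓ₀ ℓ₁ ℓ₂ ⟩
      outsideCount κ′ ℓ₀ ℓ₁ ℓ₂    ≡⟨ sym (extCount≡outsideCount κ′ κ′-emb) ⟩
      extCount Γ 𝕋 κ′             ∎
      where
      open ≡-Reasoning
      same : SamePattern κ κ′
      same i j = ⇔.trans (Col⇔Δ κ-emb i j) (⇔.sym (Col⇔Δ κ′-emb i j))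
      ¬single′ : ¬ SingleEdgeTriple κ
      ¬single′ = ¬single ∘ SingleEdge-cong (Col⇔Δ κ-emb 0F 1F) (Col⇔Δ κ-emb 0F 2F) (Col⇔Δ κ-emb 1F 2F)

mainTheorem18 : (Π : IncidenceStructure) (s t μ c : ℕ) →
    IsPartialQuadrangle Π s t μ →
    (∀ p q r → IsTriad Π p q r → centers Π p q r ≡ c) →
    (𝕋 : GraphType 3 4) →
    (∀ k → ¬ (𝕋 ≅ᵀ exceptional k)) →
    IsTRegular (pointGraph Π) 𝕋
mainTheorem18 Π s t μ c PQ triad-centers 𝕋 non-exceptional =
  invariant⇒regular (pointGraph Π) 𝕋 (extCount-cong 𝕋 triad-centers not-single-edge)
  where
  open PartialQuadrangle Π PQ
  open GraphType 𝕋 using (Δ)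
  not-single-edge : ¬ SingleEdge (Adj Δ 0F 1F) (Adj Δ 0F 2F) (Adj Δ 1F 2F)
  not-single-edge single = let k , 𝕋≅k = Apex.single-edge⇒exceptional 𝕋 single in non-exceptional k 𝕋≅k
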